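{- For integers $\ell,n\ge0$ let $A_{\ge\ell}(n)=|\mathrm{VHC}(\{\pi\in\operatorname{Av}_{n+\ell}(132,231):\mathrm{tl}(\pi)\ge\ell\})|$, and let $J(x,z)=\sum_{\ell\ge0}\sum_{n\ge0}A_{\ge\ell}(n)x^nz^\ell$. Then \[J(x,z)=\frac{(-1+2z)\bigl(1-\sqrt{1-2x-3x^2}\bigr)-x}{(1-z)\bigl(x(-2+z)+(1-\sqrt{1-2x-3x^2})z\bigr)}.\]
   Context: $S_m$ is the set of permutations of $[m]$ ($S_0$ contains only the empty permutation); $\operatorname{Av}_m(132,231)$ is the set of $\pi\in S_m$ having no subsequence in the same relative order as $132$ or as $231$. The tail length $\mathrm{tl}(\pi)$ of $\pi=\pi_1\cdots\pi_m\in S_m$ is the smallest nonnegative integer $\ell$ with $\pi_{m-\ell}\ne m-\ell$, with the convention $\mathrm{tl}(12\cdots m)=m$. Valid hook configurations. A descent of $\pi$ is $i\in[m-1]$ with $\pi_i>\pi_{i+1}$, and $(i,\pi_i)$ is a descent top of the plot $\{(i,\pi_i)\}$. A hook is determined by $i<j$ with $\pi_i<\pi_j$: vertical segment from $(i,\pi_i)$ up to $(i,\pi_j)$, then horizontal segment to $(j,\pi_j)$; southwest endpoint $(i,\pi_i)$, northeast endpoint $(j,\pi_j)$. If $\pi$ has descents $d_1<\cdots<d_k$, a valid hook configuration is a tuple $(H_1,\dots,H_k)$ of hooks such that (1) $H_i$ has southwest endpoint $(d_i,\pi_{d_i})$; (2) no point of the plot lies directly above a hook; (3) hooks do not intersect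 or overlap except that the northeast endpoint of one may be the southwest endpoint of another. $\mathrm{VHC}(\pi)$ is the set of these (configurations of distinct permutations are distinct; an increasing permutation, including the empty one, has exactly one, with no hooks); $\mathrm{VHC}(A)=\bigcup_{\pi\in A}\mathrm{VHC}(\pi)$. The identity is one of formal power series in $x,z$. -}

module Defs where

open import Data.Bool using (if_then_else_)
open import Data.Nat as ℕ using (ℕ; zero; suc; _≤_; _<_; _∸_; _+_; _<?_; _≡ᵇ_)
open import Data.Integer as ℤ using (ℤ; +_; -[1+_])
open import Data.List using (List; []; _∷_; map; filter; upTo; length; lookup)
open import Data.List.Relation.Binary.Permutation.Propositional using (_↭_)
open import Data.Product using (Σ; ∃; _×_; _,_; proj₁; proj₂)
open import Data.Sum using (_⊎_)
open import Relation.Nullary using (¬_)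
open import Relation.Binary.PropositionalEquality using (_≡_; _≢_)

-- Permutations as lists of values, positions 1-based.

oneTo : ℕ → List ℕ
oneTo m = map suc (upTo m)

-- ent π i = π_i for 1 ≤ i ≤ length π (0 otherwise)
ent : List ℕ → ℕ → ℕ
ent (x ∷ xs) (suc zero) = x
ent (x ∷ xs) (suc (suc i)) = ent xs (suc i)
ent _ _ = 0

Contains132 : List ℕ → Set
Contains132 π = ∃ λ i → ∃ λ j → ∃ λ k →
  1 ≤ i × i < j × j < k × k ≤ length π × ent π i < ent π k × ent π k < ent π j

Contains231 : List ℕ → Set
Contains231 π = ∃ λ i → ∃ λ j → ∃ λ k →
  1 ≤ i × i < j × j < k × k ≤ length π × ent π k < ent π i × ent π i < ent π j

Avoids132-231 : List ℕ → Set
Avoids132-231 π = ¬ Contains132 π × ¬ Contains231 π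

tlGo : List ℕ → ℕ → ℕ
tlGo π zero = 0
tlGo π (suc k) = if ent π (suc k) ≡ᵇ suc k then suc (tlGo π k) else 0

tl : List ℕ → ℕ
tl π = tlGo π (length π)

descents : List ℕ → List ℕ
descents π = filter (λ i → ent π (suc i) <? ent π i) (oneTo (length π ∸ 1))

-- Hooks: (i , j) = hook with SW endpoint (i, π_i) and NE endpoint (j, π_j)

Hook : Set
Hook = ℕ × ℕ

IsHook : List ℕ → Hook → Set
IsHook π (i , j) = 1 ≤ i × i < j × j ≤ length π × ent π i < ent π j

SW NE : List ℕ → Hook → ℕ × ℕ
SW π (i , j) = (i , ent π i)
NE π (i , j) = (j , ent π j)

NoPointAbove : List ℕ → Hook → Set
NoPointAbove π (i , j) = ∀ k → i < k → k < j → ent π k < ent π j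

OnHook : List ℕ → Hook → ℕ × ℕ → Set
OnHook π (i , j) (x , y) =
  (x ≡ i × ent π i ≤ y × y ≤ ent π j) ⊎ (y ≡ ent π j × i ≤ x × x ≤ j)

NonCrossing : List ℕ → Hook → Hook → Set
NonCrossing π H H′ = ∀ p → OnHook π H p → OnHook π H′ p →
  (p ≡ NE π H × p ≡ SW π H′) ⊎ (p ≡ NE π H′ × p ≡ SW π H)

IsVHC : List ℕ → List Hook → Set
IsVHC π hs =
  map proj₁ hs ≡ descents π
  × (∀ t → IsHook π (lookup hs t) × NoPointAbove π (lookup hs t))
  × (∀ s t → s ≢ t → NonCrossing π (lookup hs s) (lookup hs t))

-- Elements of VHC({π ∈ Av_{n+ℓ}(132,231) : tl(π) ≥ ℓ}); proofs irrelevant,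
-- so an element is determined by the pair (π, configuration).
record VHCObj (n ℓ : ℕ) : Set where
  constructor vhc
  field
    perm  : List ℕ
    hooks : List Hook
    .isPerm : perm ↭ oneTo (n + ℓ)
    .avoids : Avoids132-231 perm
    .tail   : ℓ ≤ tl perm
    .valid  : IsVHC perm hooks

-- Formal power series over ℤ in x, z: F n l = coefficient of x^n z^l.

Ser : Set
Ser = ℕ → ℕ → ℤ

sumTo : ℕ → (ℕ → ℤ) → ℤ
sumTo zero f = f 0
sumTo (suc n) f = sumTo n f ℤ.+ f (suc n)

_⊛_ : Ser → Ser → Ser
(F ⊛ G) n l = sumTo n (λ i → sumTo l (λ j → F i j ℤ.* G (n ∸ i) (l ∸ j)))

_⊕_ : Ser → Ser → Ser
(F ⊕ G) n l = F n l ℤ.+ G n l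

⊖_ : Ser → Ser
(⊖ F) n l = ℤ.- (F n l)

_⊝_ : Ser → Ser → Ser
F ⊝ G = F ⊕ (⊖ G)

cst : ℤ → Ser
cst c zero zero = c
cst c _ _ = + 0

X Z : Ser
X (suc zero) zero = + 1
X _ _ = + 0
Z zero (suc zero) = + 1
Z _ _ = + 0

embX : (ℕ → ℤ) → Ser
embX S n zero = S n
embX S n (suc _) = + 0

-- 1 - 2x - 3x²
disc : ℕ → ℤ
disc zero = + 1
disc (suc zero) = -[1+ 1 ]
disc (suc (suc zero)) = -[1+ 2 ]
disc _ = + 0

IsSqrtDisc : (ℕ → ℤ) → Set
IsSqrtDisc S = S 0 ≡ + 1 × (∀ n → sumTo n (λ i → S i ℤ.* S (n ∸ i)) ≡ disc n)

Num : (ℕ → ℤ) → Ser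
Num S = ((cst (ℤ.- + 1) ⊕ (cst (+ 2) ⊛ Z)) ⊛ (cst (+ 1) ⊝ embX S)) ⊝ X

Den : (ℕ → ℤ) → Ser
Den S = (cst (+ 1) ⊝ Z) ⊛ ((X ⊛ (cst (ℤ.- + 2) ⊕ Z)) ⊕ ((cst (+ 1) ⊝ embX S) ⊛ Z))

Jser : (ℕ → ℕ → ℕ) → Ser
Jser A n ℓ = + (A n ℓ)

-- In a permutation avoiding 132 and 231 the maximum is the first or the last entry.  Removing it
-- decomposes the valid hook configurations recursively, once configurations whose first k descents
-- carry no hook are counted as well: if the maximum is last, either no hook ends at it or exactly the
-- first remaining one does (a later one would create a 132 or 231 pattern or cross an earlier hook);
-- if it is first, its descent carries no hook and the tail length is 0.  The resulting recurrence
-- gives T = x (1 + T + T²) for the series T of configurations of nonempty permutations, and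
-- J(ℓ + 1) = (1 + T) J(ℓ) - T for the coefficient J(ℓ) of zˡ.  Since √(1 - 2x - 3x²) = 1 - x - 2xT,
-- these recurrences are exactly the coefficients of zˡ in J(x, z) · denominator = numerator.

module Submission where

open import Defs
import Data.Bool as Bool
open import Data.Bool using (true; false)
open import Data.Empty using (⊥; ⊥-elim; ⊥-elim-irr)
open import Data.Fin using (Fin; zero; suc)
import Data.Fin.Properties as Finₚ
open import Data.Fin.Properties using (+↔⊎)
open import Data.Fin.Permutation using (↔⇒≡)
open import Data.Integer using (ℤ; +_; -_; _+_; _*_; _-_)
import Data.Integer.Properties as ℤₚ
open import Data.Integer.Tactic.RingSolver using (solve-∀)
open import Data.Nat as ℕ using (ℕ; zero; suc; pred; _≤_; _<_; _∸_; _≡ᵇ_; _<?_; z≤n; s≤s)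
open import Data.Nat.Properties
open import Data.List using (List; []; _∷_; map; filter; upTo; length; lookup; drop; _++_; [_])
open import Data.List.Properties
  using (length-map; length-upTo; length-++; map-applyUpTo; map-++; map-∘; map-id; upTo-∷ʳ; drop-map; drop-[];
         filter-accept; filter-reject; filter-++; ++-identityʳ; ∷-injectiveˡ)
import Data.List.Properties as Listₚ
open import Data.List.Membership.Propositional using (_∈_)
open import Data.List.Membership.Propositional.Properties using (∈-++⁺ʳ)
open import Data.List.Relation.Unary.Any using (here; there)
open import Data.List.Relation.Unary.All as All using (All; []; _∷_)
import Data.List.Relation.Unary.All.Properties as Allₚ
open import Data.List.Relation.Unary.AllPairs as AllPairs using (AllPairs; []; _∷_)
import Data.List.Relation.Unary.AllPairs.Properties as AllPairsₚ
open import Data.List.Relation.Unary.Unique.Propositional using (Unique)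
import Data.List.Relation.Unary.Unique.Propositional.Properties as Uniqueₚ
open import Data.List.Relation.Binary.Permutation.Propositional using (_↭_; ↭-refl; ↭-sym; ↭-trans; ↭-prep; ↭⇒↭ₛ)
open import Data.List.Relation.Binary.Permutation.Propositional.Properties
  using (All-resp-↭; ∈-resp-↭; ↭-length; ++⁺ʳ; drop-mid; drop-∷; ∷↭∷ʳ; ↭-empty-inv; ↭-singleton-inv)
open import Data.List.Relation.Binary.Permutation.Setoid.Properties using (Unique-resp-↭)
open import Data.Product using (∃; ∃₂; _×_; _,_; proj₁; proj₂)
import Data.Product.Properties as Productₚ
open import Data.Sum as Sum using (_⊎_; inj₁; inj₂)
open import Data.Sum.Function.Propositional using (_⊎-↔_)
open import Function.Bundles using (_↔_; mk↔ₛ′)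
open import Function.Properties.Inverse using (↔-sym; ↔-trans; ↔-refl)
open import Relation.Nullary using (¬_; yes; no; Dec)
open import Relation.Nullary.Decidable using (recompute)
open import Relation.Binary.Definitions using (tri<; tri≈; tri>)
open import Relation.Binary.PropositionalEquality
  using (_≡_; _≢_; refl; sym; trans; cong; cong₂; subst; subst₂; setoid; module ≡-Reasoning)
open ≡-Reasoning

-- Permutations and their entries

oneTo-suc : ∀ n → oneTo (suc n) ≡ 1 ∷ map suc (oneTo n)
oneTo-suc n = cong (λ l → 1 ∷ map suc l) (sym (map-applyUpTo (λ x → x) suc n))

oneTo-∷ʳ : ∀ n → oneTo (suc n) ≡ oneTo n ++ [ suc n ]
oneTo-∷ʳ n = trans (cong (map suc) (sym (upTo-∷ʳ n))) (map-++ suc (upTo n) [ n ])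

oneTo-bounded : ∀ n → All (λ i → 1 ≤ i × i ≤ n) (oneTo n)
oneTo-bounded zero = []
oneTo-bounded (suc n) rewrite oneTo-suc n =
  (s≤s z≤n , s≤s z≤n) ∷ Allₚ.map⁺ (All.map (λ (_ , i≤n) → s≤s z≤n , s≤s i≤n) (oneTo-bounded n))

oneTo-sorted : ∀ n → AllPairs _<_ (oneTo n)
oneTo-sorted n = AllPairsₚ.map⁺ (AllPairs.map s≤s (AllPairsₚ.applyUpTo⁺₁ (λ i → i) n (λ i<j _ → i<j)))

oneTo-unique : ∀ n → Unique (oneTo n)
oneTo-unique n = Uniqueₚ.map⁺ suc-injective (Uniqueₚ.upTo⁺ n)

length-∷ʳ : ∀ (xs : List ℕ) x → length (xs ++ [ x ]) ≡ suc (length xs)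
length-∷ʳ xs x = trans (length-++ xs) (+-comm (length xs) 1)

ent-∈ : ∀ (xs : List ℕ) i → 1 ≤ i → i ≤ length xs → ent xs i ∈ xs
ent-∈ (x ∷ xs) (suc zero) _ _ = here refl
ent-∈ (x ∷ xs) (suc (suc i)) _ (s≤s i≤) = there (ent-∈ xs (suc i) (s≤s z≤n) i≤)

∈⇒ent : ∀ {x} (xs : List ℕ) → x ∈ xs → ∃ λ i → 1 ≤ i × i ≤ length xs × ent xs i ≡ x
∈⇒ent (y ∷ xs) (here e) = 1 , s≤s z≤n , s≤s z≤n , sym e
∈⇒ent (y ∷ xs) (there x∈) with ∈⇒ent xs x∈
... | suc i , _ , i≤ , e = suc (suc i) , s≤s z≤n , s≤s i≤ , e

All-ent : ∀ {P : ℕ → Set} (xs : List ℕ) → All P xs → ∀ i → 1 ≤ i → i ≤ length xs → P (ent xs i)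
All-ent xs ps i 1≤i i≤ = All.lookup ps (ent-∈ xs i 1≤i i≤)

ent-injective : ∀ (xs : List ℕ) → Unique xs → ∀ i j → 1 ≤ i → i ≤ length xs → 1 ≤ j → j ≤ length xs →
                ent xs i ≡ ent xs j → i ≡ j
ent-injective (x ∷ xs) u (suc zero) (suc zero) _ _ _ _ e = refl
ent-injective (x ∷ xs) (x∉ ∷ u) (suc zero) (suc (suc j)) _ _ _ (s≤s j≤) e =
  ⊥-elim (All.lookup x∉ (ent-∈ xs (suc j) (s≤s z≤n) j≤) e)
ent-injective (x ∷ xs) (x∉ ∷ u) (suc (suc i)) (suc zero) _ (s≤s i≤) _ _ e =
  ⊥-elim (All.lookup x∉ (ent-∈ xs (suc i) (s≤s z≤n) i≤) (sym e))
ent-injective (x ∷ xs) (_ ∷ u) (suc (suc i)) (suc (suc j)) _ (s≤s i≤) _ (s≤s j≤) e =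
  cong suc (ent-injective xs u (suc i) (suc j) (s≤s z≤n) i≤ (s≤s z≤n) j≤ e)

ent-∷ʳ : ∀ (xs : List ℕ) x i → i ≤ length xs → ent (xs ++ [ x ]) i ≡ ent xs i
ent-∷ʳ [] x zero _ = refl
ent-∷ʳ (y ∷ xs) x zero _ = refl
ent-∷ʳ (y ∷ xs) x (suc zero) _ = refl
ent-∷ʳ (y ∷ xs) x (suc (suc i)) (s≤s i≤) = ent-∷ʳ xs x (suc i) i≤

ent-∷ʳ-last : ∀ (xs : List ℕ) x → ent (xs ++ [ x ]) (suc (length xs)) ≡ x
ent-∷ʳ-last [] x = refl
ent-∷ʳ-last (y ∷ xs) x = ent-∷ʳ-last xs x

hd : List ℕ → ℕ
hd [] = 0
hd (x ∷ _) = x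

drop-∷-hd : ∀ k (xs : List ℕ) → suc k ≤ length xs → drop k xs ≡ hd (drop k xs) ∷ drop (suc k) xs
drop-∷-hd zero (x ∷ xs) _ = refl
drop-∷-hd (suc k) (x ∷ xs) (s≤s k<) = drop-∷-hd k xs k<

drop-≡-∷ : ∀ k (xs : List ℕ) {y ys} → drop k xs ≡ y ∷ ys → suc k ≤ length xs × drop (suc k) xs ≡ ys × hd (drop k xs) ≡ y
drop-≡-∷ zero (x ∷ xs) refl = s≤s z≤n , refl , refl
drop-≡-∷ (suc k) (x ∷ xs) eq with drop-≡-∷ k xs eq
... | k< , rest , first = s≤s k< , rest , first

All-hd-drop : ∀ {P : ℕ → Set} k (xs : List ℕ) → suc k ≤ length xs → All P xs → P (hd (drop k xs))
All-hd-drop {P} k xs k< ps = All.head (subst (All P) (drop-∷-hd k xs k<) (Allₚ.drop⁺ k ps))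

AllPairs-hd-drop : ∀ {R : ℕ → ℕ → Set} k (xs : List ℕ) → suc k ≤ length xs → AllPairs R xs → All (R (hd (drop k xs))) (drop (suc k) xs)
AllPairs-hd-drop {R} k xs k< rs = AllPairs.head (subst (AllPairs R) (drop-∷-hd k xs k<) (AllPairsₚ.drop⁺ k rs))

dropLast : List ℕ → List ℕ
dropLast [] = []
dropLast (x ∷ []) = []
dropLast (x ∷ y ∷ xs) = x ∷ dropLast (y ∷ xs)

dropLast-∷ʳ : ∀ xs x → dropLast (xs ++ [ x ]) ≡ xs
dropLast-∷ʳ [] x = refl
dropLast-∷ʳ (y ∷ []) x = refl
dropLast-∷ʳ (y ∷ z ∷ xs) x = cong (y ∷_) (dropLast-∷ʳ (z ∷ xs) x)

dropLast-++-last : ∀ x xs → x ∷ xs ≡ dropLast (x ∷ xs) ++ [ ent (x ∷ xs) (suc (length xs)) ]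
dropLast-++-last x [] = refl
dropLast-++-last x (y ∷ xs) = cong (x ∷_) (dropLast-++-last y xs)

module _ {A : Set} where

  All-lookup⁺ : ∀ {P : A → Set} (xs : List A) → (∀ t → P (lookup xs t)) → All P xs
  All-lookup⁺ [] f = []
  All-lookup⁺ (x ∷ xs) f = f zero ∷ All-lookup⁺ xs (λ t → f (suc t))

  All-lookup⁻ : ∀ {P : A → Set} {xs : List A} → All P xs → ∀ t → P (lookup xs t)
  All-lookup⁻ (p ∷ ps) zero = p
  All-lookup⁻ (p ∷ ps) (suc t) = All-lookup⁻ ps t

  AllPairs-lookup⁺ : ∀ {R : A → A → Set} (xs : List A) → (∀ s t → s ≢ t → R (lookup xs s) (lookup xs t)) →
                     AllPairs (λ a b → R a b × R b a) xs
  AllPairs-lookup⁺ [] f = []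
  AllPairs-lookup⁺ (x ∷ xs) f =
    All-lookup⁺ xs (λ t → f zero (suc t) (λ ()) , f (suc t) zero (λ ())) ∷
    AllPairs-lookup⁺ xs (λ s t s≢t → f (suc s) (suc t) (λ e → s≢t (Finₚ.suc-injective e)))

  AllPairs-lookup⁻ : ∀ {R : A → A → Set} {xs : List A} → AllPairs (λ a b → R a b × R b a) xs →
                     ∀ s t → s ≢ t → R (lookup xs s) (lookup xs t)
  AllPairs-lookup⁻ (_ ∷ rs) zero zero s≢t = ⊥-elim (s≢t refl)
  AllPairs-lookup⁻ (r ∷ rs) zero (suc t) _ = proj₁ (All-lookup⁻ r t)
  AllPairs-lookup⁻ (r ∷ rs) (suc s) zero _ = proj₂ (All-lookup⁻ r s)
  AllPairs-lookup⁻ (_ ∷ rs) (suc s) (suc t) s≢t = AllPairs-lookup⁻ rs s t (λ e → s≢t (cong suc e))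

  AllPairs-mapWith : ∀ {P : A → Set} {R R′ : A → A → Set} {xs} → All P xs → AllPairs R xs →
                     (∀ {a b} → P a → P b → R a b → R′ a b) → AllPairs R′ xs
  AllPairs-mapWith [] [] f = []
  AllPairs-mapWith (p ∷ ps) (r ∷ rs) f = All.zipWith (λ (q , s) → f p q s) (ps , r) ∷ AllPairs-mapWith ps rs f

module Permutation {π : List ℕ} {N : ℕ} (p : π ↭ oneTo N) where

  length≡ : length π ≡ N
  length≡ = trans (↭-length p) (trans (length-map suc (upTo N)) (length-upTo N))

  bounded : All (λ i → 1 ≤ i × i ≤ N) π
  bounded = All-resp-↭ (↭-sym p) (oneTo-bounded N)

  unique : Unique π
  unique = Unique-resp-↭ (setoid ℕ) (↭⇒↭ₛ (↭-sym p)) (oneTo-unique N)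

  ≤length : ∀ {i} → i ≤ N → i ≤ length π
  ≤length = subst (_ ≤_) (sym length≡)

  ent-bounded : ∀ i → 1 ≤ i → i ≤ N → 1 ≤ ent π i × ent π i ≤ N
  ent-bounded i 1≤i i≤N = All-ent π bounded i 1≤i (≤length i≤N)

  ent<max : ∀ i j → 1 ≤ i → i ≤ N → 1 ≤ j → j ≤ N → ent π j ≡ N → i ≢ j → ent π i < N
  ent<max i j 1≤i i≤N 1≤j j≤N πj≡N i≢j with m≤n⇒m<n∨m≡n (proj₂ (ent-bounded i 1≤i i≤N))
  ... | inj₁ πi<N = πi<N
  ... | inj₂ πi≡N = ⊥-elim (i≢j (ent-injective π unique i j 1≤i (≤length i≤N) 1≤j (≤length j≤N) (trans πi≡N (sym πj≡N))))

  max∈ : ∀ n → N ≡ suc n → N ∈ π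
  max∈ n refl = ∈-resp-↭ (↭-sym p) (subst (suc n ∈_) (sym (oneTo-∷ʳ n)) (∈-++⁺ʳ (oneTo n) (here refl)))

-- Avoiding 132 and 231

module _ {π : List ℕ} (u : Unique π) (av : Avoids132-231 π) where

  no-peak : ∀ i j k → 1 ≤ i → i < j → j < k → k ≤ length π → ent π i < ent π j → ent π k < ent π j → ⊥
  no-peak i j k 1≤i i<j j<k k≤ πi<πj πk<πj with <-cmp (ent π i) (ent π k)
  ... | tri< πi<πk _ _ = proj₁ av (i , j , k , 1≤i , i<j , j<k , k≤ , πi<πk , πk<πj)
  ... | tri> _ _ πk<πi = proj₂ av (i , j , k , 1≤i , i<j , j<k , k≤ , πk<πi , πi<πj)
  ... | tri≈ _ πi≡πk _ = <-irrefl (ent-injective π u i k 1≤i (≤-trans (<⇒≤ i<k) k≤) (≤-trans 1≤i (<⇒≤ i<k)) k≤ πi≡πk) i<k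
    where
      i<k : i < k
      i<k = <-trans i<j j<k

max-first-or-last : ∀ {π n} → π ↭ oneTo (suc n) → Avoids132-231 π → ent π 1 ≡ suc n ⊎ ent π (suc n) ≡ suc n
max-first-or-last {π} {n} p av with ∈⇒ent π (Permutation.max∈ p n refl)
... | suc zero , _ , _ , π₁≡N = inj₁ π₁≡N
... | suc (suc q) , _ , i≤ , πi≡N with suc (suc q) ℕ.≟ suc n
...   | yes refl = inj₂ πi≡N
...   | no i≢N = ⊥-elim (no-peak unique av 1 i (suc n) (s≤s z≤n) (s≤s (s≤s z≤n)) (≤∧≢⇒< i≤N i≢N) (≤length ≤-refl)
                   (subst (ent π 1 <_) (sym πi≡N) (ent<max 1 i (s≤s z≤n) (s≤s z≤n) (s≤s z≤n) i≤N πi≡N (λ ())))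
                   (subst (ent π (suc n) <_) (sym πi≡N) (ent<max (suc n) i (s≤s z≤n) ≤-refl (s≤s z≤n) i≤N πi≡N (λ e → i≢N (sym e)))))
  where
    open Permutation p
    i : ℕ
    i = suc (suc q)
    i≤N : i ≤ suc n
    i≤N = subst (i ≤_) length≡ i≤

module _ (π : List ℕ) (x : ℕ) where
  private
    L : ℕ
    L = length π
    E : ∀ i → i ≤ L → ent (π ++ [ x ]) i ≡ ent π i
    E = ent-∷ʳ π x
    ≤L+1 : ∀ {k} → k ≤ L → k ≤ length (π ++ [ x ])
    ≤L+1 k≤L = subst (_ ≤_) (sym (length-∷ʳ π x)) (m≤n⇒m≤1+n k≤L)

  avoids-∷ʳ⁻ : Avoids132-231 (π ++ [ x ]) → Avoids132-231 π
  avoids-∷ʳ⁻ (no132 , no231) =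
    (λ (i , j , k , 1≤i , i<j , j<k , k≤ , πi<πk , πk<πj) →
       no132 (i , j , k , 1≤i , i<j , j<k , ≤L+1 k≤ ,
              subst₂ _<_ (sym (E i (i≤ i<j j<k k≤))) (sym (E k k≤)) πi<πk ,
              subst₂ _<_ (sym (E k k≤)) (sym (E j (≤-trans (<⇒≤ j<k) k≤))) πk<πj)) ,
    (λ (i , j , k , 1≤i , i<j , j<k , k≤ , πk<πi , πi<πj) →
       no231 (i , j , k , 1≤i , i<j , j<k , ≤L+1 k≤ ,
              subst₂ _<_ (sym (E k k≤)) (sym (E i (i≤ i<j j<k k≤))) πk<πi ,
              subst₂ _<_ (sym (E i (i≤ i<j j<k k≤))) (sym (E j (≤-trans (<⇒≤ j<k) k≤))) πi<πj))
    where
      i≤ : ∀ {i j k} → i < j → j < k → k ≤ L → i ≤ L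
      i≤ i<j j<k k≤ = ≤-trans (<⇒≤ (<-trans i<j j<k)) k≤

  avoids-∷ʳ⁺ : Avoids132-231 π → All (_< x) π → Avoids132-231 (π ++ [ x ])
  avoids-∷ʳ⁺ (no132 , no231) π<x = no132′ , no231′
    where
      k≤L+1 : ∀ {k} → k ≤ length (π ++ [ x ]) → k ≤ suc L
      k≤L+1 = subst (_ ≤_) (length-∷ʳ π x)
      below-x : ∀ j → 1 ≤ j → j ≤ L → ent (π ++ [ x ]) j < x
      below-x j 1≤j j≤L = subst (_< x) (sym (E j j≤L)) (All-ent π π<x j 1≤j j≤L)
      last-is-x : ∀ j → 1 ≤ j → j < suc L → ent (π ++ [ x ]) j < ent (π ++ [ x ]) (suc L)
      last-is-x j 1≤j j<L+1 = subst (ent (π ++ [ x ]) j <_) (sym (ent-∷ʳ-last π x)) (below-x j 1≤j (≤-pred j<L+1))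
      no132′ : ¬ Contains132 (π ++ [ x ])
      no132′ (i , j , k , 1≤i , i<j , j<k , k≤ , πi<πk , πk<πj) with m≤n⇒m<n∨m≡n (k≤L+1 k≤)
      ... | inj₁ (s≤s k≤L) = no132 (i , j , k , 1≤i , i<j , j<k , k≤L ,
              subst₂ _<_ (E i (≤-trans (<⇒≤ (<-trans i<j j<k)) k≤L)) (E k k≤L) πi<πk ,
              subst₂ _<_ (E k k≤L) (E j (≤-trans (<⇒≤ j<k) k≤L)) πk<πj)
      ... | inj₂ refl = <-asym πk<πj (last-is-x j (≤-trans 1≤i (<⇒≤ i<j)) j<k)
      no231′ : ¬ Contains231 (π ++ [ x ])
      no231′ (i , j , k , 1≤i , i<j , j<k , k≤ , πk<πi , πi<πj) with m≤n⇒m<n∨m≡n (k≤L+1 k≤)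
      ... | inj₁ (s≤s k≤L) = no231 (i , j , k , 1≤i , i<j , j<k , k≤L ,
              subst₂ _<_ (E k k≤L) (E i (≤-trans (<⇒≤ (<-trans i<j j<k)) k≤L)) πk<πi ,
              subst₂ _<_ (E i (≤-trans (<⇒≤ (<-trans i<j j<k)) k≤L)) (E j (≤-trans (<⇒≤ j<k) k≤L)) πi<πj)
      ... | inj₂ refl = <-asym (<-trans πk<πi πi<πj) (last-is-x j (≤-trans 1≤i (<⇒≤ i<j)) j<k)

  avoids-∷⁻ : Avoids132-231 (x ∷ π) → Avoids132-231 π
  avoids-∷⁻ (no132 , no231) =
    (λ { (suc i , suc j , suc k , _ , i<j , j<k , k≤ , πi<πk , πk<πj) →
           no132 (suc (suc i) , suc (suc j) , suc (suc k) , s≤s z≤n , s≤s i<j , s≤s j<k , s≤s k≤ , πi<πk , πk<πj) }) ,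
    (λ { (suc i , suc j , suc k , _ , i<j , j<k , k≤ , πk<πi , πi<πj) →
           no231 (suc (suc i) , suc (suc j) , suc (suc k) , s≤s z≤n , s≤s i<j , s≤s j<k , s≤s k≤ , πk<πi , πi<πj) })

  avoids-∷⁺ : Avoids132-231 π → All (_< x) π → Avoids132-231 (x ∷ π)
  avoids-∷⁺ (no132 , no231) π<x = no132′ , no231′
    where
      below-x : ∀ k → 2 ≤ k → k ≤ suc L → ent (x ∷ π) k < x
      below-x (suc (suc k)) _ (s≤s k≤) = All-ent π π<x (suc k) (s≤s z≤n) k≤
      below-x (suc zero) (s≤s ()) _
      no132′ : ¬ Contains132 (x ∷ π)
      no132′ (suc zero , j , k , _ , i<j , j<k , k≤ , πi<πk , _) = <-asym πi<πk (below-x k (<-trans i<j j<k) k≤)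
      no132′ (suc (suc i) , suc (suc j) , suc (suc k) , _ , s≤s i<j , s≤s j<k , s≤s k≤ , πi<πk , πk<πj) =
        no132 (suc i , suc j , suc k , s≤s z≤n , i<j , j<k , k≤ , πi<πk , πk<πj)
      no231′ : ¬ Contains231 (x ∷ π)
      no231′ (suc zero , j , k , _ , i<j , j<k , k≤ , _ , πi<πj) = <-asym πi<πj (below-x j i<j (≤-trans (<⇒≤ j<k) k≤))
      no231′ (suc (suc i) , suc (suc j) , suc (suc k) , _ , s≤s i<j , s≤s j<k , s≤s k≤ , πk<πi , πi<πj) =
        no231 (suc i , suc j , suc k , s≤s z≤n , i<j , j<k , k≤ , πk<πi , πi<πj)

  tlGo-∷ʳ : ∀ k → k ≤ L → tlGo (π ++ [ x ]) k ≡ tlGo π k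
  tlGo-∷ʳ zero _ = refl
  tlGo-∷ʳ (suc k) k<L rewrite E (suc k) k<L | tlGo-∷ʳ k (≤-trans (n≤1+n k) k<L) = refl

  tl-∷ʳ-fixed : x ≡ suc L → tl (π ++ [ x ]) ≡ suc (tl π)
  tl-∷ʳ-fixed refl rewrite length-∷ʳ π x | ent-∷ʳ-last π x | tlGo-∷ʳ L ≤-refl with suc L ≡ᵇ suc L in eq
  ... | true = refl
  ... | false = ⊥-elim (subst Bool.T eq (≡⇒≡ᵇ (suc L) (suc L) refl))

  tl-∷-unfixed : ent (x ∷ π) (suc L) ≢ suc L → tl (x ∷ π) ≡ 0
  tl-∷-unfixed not-fixed with ent (x ∷ π) (suc L) ≡ᵇ suc L in eq
  ... | false = refl
  ... | true = ⊥-elim (not-fixed (≡ᵇ⇒≡ _ _ (subst Bool.T (sym eq) _)))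

-- Descents and hooks

IsDescent : List ℕ → ℕ → Set
IsDescent π i = ent π (suc i) < ent π i

descent? : ∀ π i → Dec (IsDescent π i)
descent? π i = ent π (suc i) <? ent π i

filter-descent-cong : ∀ π π′ (xs : List ℕ) → All (λ i → (IsDescent π i → IsDescent π′ i) × (IsDescent π′ i → IsDescent π i)) xs →
                      filter (descent? π) xs ≡ filter (descent? π′) xs
filter-descent-cong π π′ [] [] = refl
filter-descent-cong π π′ (x ∷ xs) ((to , from) ∷ iffs) with descent? π x
... | yes d = trans (filter-accept (descent? π) d)
                (trans (cong (x ∷_) (filter-descent-cong π π′ xs iffs)) (sym (filter-accept (descent? π′) (to d))))
... | no ¬d = trans (filter-reject (descent? π) ¬d)
                (trans (filter-descent-cong π π′ xs iffs) (sym (filter-reject (descent? π′) (λ d → ¬d (from d)))))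

filter-descent-map-suc : ∀ π π′ (xs : List ℕ) →
                         All (λ i → (IsDescent π (suc i) → IsDescent π′ i) × (IsDescent π′ i → IsDescent π (suc i))) xs →
                         filter (descent? π) (map suc xs) ≡ map suc (filter (descent? π′) xs)
filter-descent-map-suc π π′ [] [] = refl
filter-descent-map-suc π π′ (x ∷ xs) ((to , from) ∷ iffs) with descent? π (suc x)
... | yes d = trans (filter-accept (descent? π) d)
                (trans (cong (suc x ∷_) (filter-descent-map-suc π π′ xs iffs)) (cong (map suc) (sym (filter-accept (descent? π′) (to d)))))
... | no ¬d = trans (filter-reject (descent? π) ¬d)
                (trans (filter-descent-map-suc π π′ xs iffs) (cong (map suc) (sym (filter-reject (descent? π′) (λ d → ¬d (from d))))))

descents-∷ʳ-max : ∀ π x → All (_< x) π → descents (π ++ [ x ]) ≡ descents π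
descents-∷ʳ-max [] x _ = refl
descents-∷ʳ-max (y ∷ π) x π<x = begin
    filter (descent? P) (oneTo (length (y ∷ π ++ [ x ]) ∸ 1))
      ≡⟨ cong (λ l → filter (descent? P) (oneTo l)) (length-∷ʳ π x) ⟩
    filter (descent? P) (oneTo (suc L))
      ≡⟨ cong (filter (descent? P)) (oneTo-∷ʳ L) ⟩
    filter (descent? P) (oneTo L ++ [ suc L ])
      ≡⟨ filter-++ (descent? P) (oneTo L) [ suc L ] ⟩
    filter (descent? P) (oneTo L) ++ filter (descent? P) [ suc L ]
      ≡⟨ cong (filter (descent? P) (oneTo L) ++_) (filter-reject (descent? P) {x = suc L} {xs = []} last-not-descent) ⟩
    filter (descent? P) (oneTo L) ++ []
      ≡⟨ ++-identityʳ _ ⟩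
    filter (descent? P) (oneTo L)
      ≡⟨ filter-descent-cong P (y ∷ π) (oneTo L) (All.map same-descent (oneTo-bounded L)) ⟩
    descents (y ∷ π) ∎
  where
    P : List ℕ
    P = y ∷ π ++ [ x ]
    L : ℕ
    L = length π
    E = ent-∷ʳ (y ∷ π) x
    last-not-descent : ¬ IsDescent P (suc L)
    last-not-descent d = <-asym d (subst₂ _<_ (sym (E (suc L) ≤-refl)) (sym (ent-∷ʳ-last (y ∷ π) x))
                                     (All-ent (y ∷ π) π<x (suc L) (s≤s z≤n) ≤-refl))
    same-descent : ∀ {i} → 1 ≤ i × i ≤ L → (IsDescent P i → IsDescent (y ∷ π) i) × (IsDescent (y ∷ π) i → IsDescent P i)
    same-descent {i} (_ , i≤L) =
      subst₂ _<_ (E (suc i) (s≤s i≤L)) (E i (m≤n⇒m≤1+n i≤L)) ,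
      subst₂ _<_ (sym (E (suc i) (s≤s i≤L))) (sym (E i (m≤n⇒m≤1+n i≤L)))

descents-∷-descent : ∀ x y π → y < x → descents (x ∷ y ∷ π) ≡ 1 ∷ map suc (descents (y ∷ π))
descents-∷-descent x y π y<x = begin
    filter (descent? P) (oneTo (suc (length π)))
      ≡⟨ cong (filter (descent? P)) (oneTo-suc (length π)) ⟩
    filter (descent? P) (1 ∷ map suc (oneTo (length π)))
      ≡⟨ filter-accept (descent? P) y<x ⟩
    1 ∷ filter (descent? P) (map suc (oneTo (length π)))
      ≡⟨ cong (1 ∷_) (filter-descent-map-suc P (y ∷ π) (oneTo (length π)) (All.map shifted (oneTo-bounded (length π)))) ⟩
    1 ∷ map suc (descents (y ∷ π)) ∎
  where
    P : List ℕ
    P = x ∷ y ∷ π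
    shifted : ∀ {i} → 1 ≤ i × i ≤ length π → (IsDescent P (suc i) → IsDescent (y ∷ π) i) × (IsDescent (y ∷ π) i → IsDescent P (suc i))
    shifted {suc i} _ = (λ d → d) , (λ d → d)

IsDescentOf : List ℕ → ℕ → Set
IsDescentOf π d = (1 ≤ d × d ≤ length π ∸ 1) × IsDescent π d

descents-are-descents : ∀ π → All (IsDescentOf π) (descents π)
descents-are-descents π = All.zip (Allₚ.filter⁺ (descent? π) (oneTo-bounded (length π ∸ 1)) , Allₚ.all-filter (descent? π) (oneTo (length π ∸ 1)))

descents-sorted : ∀ π → AllPairs _<_ (descents π)
descents-sorted π = AllPairsₚ.filter⁺ (descent? π) (oneTo-sorted (length π ∸ 1))

IsValidHook : List ℕ → Hook → Set
IsValidHook π h = IsHook π h × NoPointAbove π h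

Compatible : List ℕ → Hook → Hook → Set
Compatible π h h′ = NonCrossing π h h′ × NonCrossing π h′ h

OnHook-transport : ∀ π π′ i j p → ent π i ≡ ent π′ i → ent π j ≡ ent π′ j → OnHook π (i , j) p → OnHook π′ (i , j) p
OnHook-transport π π′ i j p πi≡ πj≡ on rewrite πi≡ | πj≡ = on

NonCrossing-transport : ∀ π π′ i j i′ j′ → ent π i ≡ ent π′ i → ent π j ≡ ent π′ j →
                        ent π i′ ≡ ent π′ i′ → ent π j′ ≡ ent π′ j′ →
                        NonCrossing π (i , j) (i′ , j′) → NonCrossing π′ (i , j) (i′ , j′)
NonCrossing-transport π π′ i j i′ j′ e₁ e₂ e₃ e₄ nc p on on′
  with nc p (OnHook-transport π′ π i j p (sym e₁) (sym e₂) on) (OnHook-transport π′ π i′ j′ p (sym e₃) (sym e₄) on′)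
... | inj₁ (ne , sw) = inj₁ (trans ne (cong (j ,_) e₂) , trans sw (cong (i′ ,_) e₃))
... | inj₂ (ne , sw) = inj₂ (trans ne (cong (j′ ,_) e₄) , trans sw (cong (i ,_) e₁))

hooks-disjoint : ∀ π d J i j p → ent π j < ent π J → d < i → OnHook π (d , J) p → OnHook π (i , j) p → ⊥
hooks-disjoint π d J i j _ _ d<i (inj₁ (refl , _)) (inj₁ (refl , _)) = <-irrefl refl d<i
hooks-disjoint π d J i j _ _ d<i (inj₁ (refl , _)) (inj₂ (_ , i≤x , _)) = <-irrefl refl (<-≤-trans d<i i≤x)
hooks-disjoint π d J i j _ πj<πJ _ (inj₂ (y≡ , _)) (inj₁ (_ , _ , y≤)) = <-irrefl refl (≤-<-trans (subst (_≤ ent π j) y≡ y≤) πj<πJ)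
hooks-disjoint π d J i j _ πj<πJ _ (inj₂ (y≡ , _)) (inj₂ (y≡′ , _)) = <-irrefl (trans (sym y≡′) y≡) πj<πJ

module _ (π : List ℕ) (x : ℕ) where
  private
    L : ℕ
    L = length π
    E : ∀ i → i ≤ L → ent (π ++ [ x ]) i ≡ ent π i
    E = ent-∷ʳ π x

  IsValidHook-∷ʳ⁺ : ∀ {i j} → IsValidHook π (i , j) → IsValidHook (π ++ [ x ]) (i , j)
  IsValidHook-∷ʳ⁺ {i} {j} ((1≤i , i<j , j≤L , πi<πj) , above) =
    (1≤i , i<j , ≤-trans j≤L (subst (L ≤_) (sym (length-∷ʳ π x)) (n≤1+n L)) ,
      subst₂ _<_ (sym (E i (≤-trans (<⇒≤ i<j) j≤L))) (sym (E j j≤L)) πi<πj) ,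
    λ k i<k k<j → subst₂ _<_ (sym (E k (≤-trans (<⇒≤ k<j) j≤L))) (sym (E j j≤L)) (above k i<k k<j)

  IsValidHook-∷ʳ⁻ : ∀ {i j} → j ≤ L → IsValidHook (π ++ [ x ]) (i , j) → IsValidHook π (i , j)
  IsValidHook-∷ʳ⁻ {i} {j} j≤L ((1≤i , i<j , _ , πi<πj) , above) =
    (1≤i , i<j , j≤L , subst₂ _<_ (E i (≤-trans (<⇒≤ i<j) j≤L)) (E j j≤L) πi<πj) ,
    λ k i<k k<j → subst₂ _<_ (E k (≤-trans (<⇒≤ k<j) j≤L)) (E j j≤L) (above k i<k k<j)

  private
   NonCrossing-∷ʳ⁺ : ∀ {i j i′ j′} → i ≤ j → j ≤ L → i′ ≤ j′ → j′ ≤ L →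
                    NonCrossing π (i , j) (i′ , j′) → NonCrossing (π ++ [ x ]) (i , j) (i′ , j′)
   NonCrossing-∷ʳ⁺ {i} {j} {i′} {j′} i≤j j≤L i′≤j′ j′≤L = NonCrossing-transport π (π ++ [ x ]) i j i′ j′
    (sym (E i (≤-trans i≤j j≤L))) (sym (E j j≤L)) (sym (E i′ (≤-trans i′≤j′ j′≤L))) (sym (E j′ j′≤L))

   NonCrossing-∷ʳ⁻ : ∀ {i j i′ j′} → i ≤ j → j ≤ L → i′ ≤ j′ → j′ ≤ L →
                    NonCrossing (π ++ [ x ]) (i , j) (i′ , j′) → NonCrossing π (i , j) (i′ , j′)
   NonCrossing-∷ʳ⁻ {i} {j} {i′} {j′} i≤j j≤L i′≤j′ j′≤L = NonCrossing-transport (π ++ [ x ]) π i j i′ j′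
    (E i (≤-trans i≤j j≤L)) (E j j≤L) (E i′ (≤-trans i′≤j′ j′≤L)) (E j′ j′≤L)

  Compatible-∷ʳ⁺ : ∀ {h h′} → IsValidHook π h → IsValidHook π h′ → Compatible π h h′ → Compatible (π ++ [ x ]) h h′
  Compatible-∷ʳ⁺ ((_ , i<j , j≤L , _) , _) ((_ , i′<j′ , j′≤L , _) , _) (nc , nc′) =
    NonCrossing-∷ʳ⁺ (<⇒≤ i<j) j≤L (<⇒≤ i′<j′) j′≤L nc , NonCrossing-∷ʳ⁺ (<⇒≤ i′<j′) j′≤L (<⇒≤ i<j) j≤L nc′

  Compatible-∷ʳ⁻ : ∀ {h h′} → proj₂ h ≤ L → proj₂ h′ ≤ L → IsValidHook (π ++ [ x ]) h → IsValidHook (π ++ [ x ]) h′ →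
                   Compatible (π ++ [ x ]) h h′ → Compatible π h h′
  Compatible-∷ʳ⁻ j≤L j′≤L ((_ , i<j , _) , _) ((_ , i′<j′ , _) , _) (nc , nc′) =
    NonCrossing-∷ʳ⁻ (<⇒≤ i<j) j≤L (<⇒≤ i′<j′) j′≤L nc , NonCrossing-∷ʳ⁻ (<⇒≤ i′<j′) j′≤L (<⇒≤ i<j) j≤L nc′

shiftHook unshiftHook : Hook → Hook
shiftHook (i , j) = (suc i , suc j)
unshiftHook (i , j) = (pred i , pred j)

module _ (π : List ℕ) (x : ℕ) where

  IsValidHook-∷⁺ : ∀ h → IsValidHook π h → IsValidHook (x ∷ π) (shiftHook h)
  IsValidHook-∷⁺ (suc a , suc b) ((_ , i<j , j≤ , πi<πj) , above) =
    (s≤s z≤n , s≤s i<j , s≤s j≤ , πi<πj) , λ { (suc (suc k)) (s≤s i<k) (s≤s k<j) → above (suc k) i<k k<j }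
  IsValidHook-∷⁺ (zero , _) ((() , _) , _)
  IsValidHook-∷⁺ (suc a , zero) ((_ , () , _) , _)

  private
    valid-∷-shape : ∀ h → 2 ≤ proj₁ h → IsValidHook (x ∷ π) h → ∃₂ λ a b → h ≡ (suc (suc a) , suc (suc b))
    valid-∷-shape (suc (suc a) , suc (suc b)) _ _ = a , b , refl
    valid-∷-shape (suc (suc a) , suc zero) _ ((_ , s≤s () , _) , _)
    valid-∷-shape (suc (suc a) , zero) _ ((_ , () , _) , _)
    valid-∷-shape (suc zero , _) (s≤s ()) _
    valid-∷-shape (zero , _) () _

  IsValidHook-∷⁻ : ∀ h → 2 ≤ proj₁ h → IsValidHook (x ∷ π) h → IsValidHook π (unshiftHook h)
  IsValidHook-∷⁻ h 2≤i v with valid-∷-shape h 2≤i v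
  IsValidHook-∷⁻ _ _ ((_ , s≤s i<j , s≤s j≤ , πi<πj) , above) | a , b , refl =
    (s≤s z≤n , i<j , j≤ , πi<πj) , λ { (suc k) i<k k<j → above (suc (suc k)) (s≤s i<k) (s≤s k<j) }

  private
    shiftPoint unshiftPoint : ℕ × ℕ → ℕ × ℕ
    shiftPoint (X , Y) = (suc X , Y)
    unshiftPoint (X , Y) = (pred X , Y)

    OnHook-∷⁻ : ∀ a b X Y → OnHook (x ∷ π) (suc (suc a) , suc (suc b)) (suc X , Y) → OnHook π (suc a , suc b) (X , Y)
    OnHook-∷⁻ a b X Y (inj₁ (X≡ , lo , hi)) = inj₁ (suc-injective X≡ , lo , hi)
    OnHook-∷⁻ a b X Y (inj₂ (Y≡ , s≤s lo , s≤s hi)) = inj₂ (Y≡ , lo , hi)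

    OnHook-∷⁺ : ∀ a b X Y → OnHook π (suc a , suc b) (X , Y) → OnHook (x ∷ π) (suc (suc a) , suc (suc b)) (suc X , Y)
    OnHook-∷⁺ a b X Y (inj₁ (X≡ , lo , hi)) = inj₁ (cong suc X≡ , lo , hi)
    OnHook-∷⁺ a b X Y (inj₂ (Y≡ , lo , hi)) = inj₂ (Y≡ , s≤s lo , s≤s hi)

    OnHook-∷-positive : ∀ a b X Y → OnHook (x ∷ π) (suc (suc a) , suc (suc b)) (X , Y) → ∃ λ X′ → X ≡ suc X′
    OnHook-∷-positive a b X Y (inj₁ (refl , _)) = suc a , refl
    OnHook-∷-positive a b (suc X) Y (inj₂ (_ , s≤s _ , _)) = X , refl

    NonCrossing-∷⁺ : ∀ a b a′ b′ → NonCrossing π (suc a , suc b) (suc a′ , suc b′) →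
                     NonCrossing (x ∷ π) (suc (suc a) , suc (suc b)) (suc (suc a′) , suc (suc b′))
    NonCrossing-∷⁺ a b a′ b′ nc (X , Y) on on′ with OnHook-∷-positive a b X Y on
    ... | X′ , refl with nc (X′ , Y) (OnHook-∷⁻ a b X′ Y on) (OnHook-∷⁻ a′ b′ X′ Y on′)
    ...   | inj₁ (ne , sw) = inj₁ (cong shiftPoint ne , cong shiftPoint sw)
    ...   | inj₂ (ne , sw) = inj₂ (cong shiftPoint ne , cong shiftPoint sw)

    NonCrossing-∷⁻ : ∀ a b a′ b′ → NonCrossing (x ∷ π) (suc (suc a) , suc (suc b)) (suc (suc a′) , suc (suc b′)) →
                     NonCrossing π (suc a , suc b) (suc a′ , suc b′)
    NonCrossing-∷⁻ a b a′ b′ nc (X , Y) on on′ with nc (suc X , Y) (OnHook-∷⁺ a b X Y on) (OnHook-∷⁺ a′ b′ X Y on′)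
    ... | inj₁ (ne , sw) = inj₁ (cong unshiftPoint ne , cong unshiftPoint sw)
    ... | inj₂ (ne , sw) = inj₂ (cong unshiftPoint ne , cong unshiftPoint sw)

  Compatible-∷⁺ : ∀ {h h′} → IsValidHook π h → IsValidHook π h′ → Compatible π h h′ → Compatible (x ∷ π) (shiftHook h) (shiftHook h′)
  Compatible-∷⁺ {suc a , suc b} {suc a′ , suc b′} _ _ (nc , nc′) = NonCrossing-∷⁺ a b a′ b′ nc , NonCrossing-∷⁺ a′ b′ a b nc′
  Compatible-∷⁺ {zero , _} ((() , _) , _) _ _
  Compatible-∷⁺ {suc a , zero} ((_ , () , _) , _) _ _
  Compatible-∷⁺ {suc a , suc b} {zero , _} _ ((() , _) , _) _
  Compatible-∷⁺ {suc a , suc b} {suc a′ , zero} _ ((_ , () , _) , _) _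

  Compatible-∷⁻ : ∀ {h h′} → 2 ≤ proj₁ h → 2 ≤ proj₁ h′ → IsValidHook (x ∷ π) h → IsValidHook (x ∷ π) h′ →
                  Compatible (x ∷ π) h h′ → Compatible π (unshiftHook h) (unshiftHook h′)
  Compatible-∷⁻ {h} {h′} 2≤i 2≤i′ v v′ (nc , nc′) with valid-∷-shape h 2≤i v | valid-∷-shape h′ 2≤i′ v′
  ... | a , b , refl | a′ , b′ , refl = NonCrossing-∷⁻ a b a′ b′ nc , NonCrossing-∷⁻ a′ b′ a b nc′

shiftHook-unshiftHook : ∀ {π} → (hs : List Hook) → All (IsValidHook π) hs → map shiftHook (map unshiftHook hs) ≡ hs
shiftHook-unshiftHook [] [] = refl
shiftHook-unshiftHook {π} ((suc i , suc j) ∷ hs) (_ ∷ valid) = cong ((suc i , suc j) ∷_) (shiftHook-unshiftHook {π} hs valid)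
shiftHook-unshiftHook ((zero , _) ∷ hs) (((() , _) , _) ∷ _)
shiftHook-unshiftHook ((suc i , zero) ∷ hs) (((_ , () , _) , _) ∷ _)

sources-shiftHook : ∀ hs → map proj₁ (map shiftHook hs) ≡ map suc (map proj₁ hs)
sources-shiftHook hs = trans (sym (map-∘ hs)) (map-∘ hs)

sources-unshiftHook : ∀ hs → map proj₁ (map unshiftHook hs) ≡ map pred (map proj₁ hs)
sources-unshiftHook hs = trans (sym (map-∘ hs)) (map-∘ hs)

unshiftHook-shiftHook : ∀ hs → map unshiftHook (map shiftHook hs) ≡ hs
unshiftHook-shiftHook hs = trans (sym (map-∘ hs)) (map-id hs)

-- Configurations

-- Hooks are only attached to the descents after the first k; k = 0 gives the valid hook configurations.
record IsVHCFrom (π : List ℕ) (k : ℕ) (hs : List Hook) : Set where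
  constructor mkVHCFrom
  field
    k≤ : k ≤ length (descents π)
    sources : map proj₁ hs ≡ drop k (descents π)
    valid : All (IsValidHook π) hs
    compatible : AllPairs (Compatible π) hs

record Config (m k ℓ : ℕ) : Set where
  constructor config
  field
    perm : List ℕ
    hooks : List Hook
    .isPerm : perm ↭ oneTo m
    .avoids : Avoids132-231 perm
    .tail : ℓ ≤ tl perm
    .isVHC : IsVHCFrom perm k hooks

config-≡ : ∀ {m k ℓ π π′ hs hs′} .{p p′ a a′ t t′ v v′} → π ≡ π′ → hs ≡ hs′ →
           config {m} {k} {ℓ} π hs p a t v ≡ config π′ hs′ p′ a′ t′ v′
config-≡ refl refl = refl

recompute-perm : ∀ {π π′ : List ℕ} → .(π ≡ π′) → π ≡ π′
recompute-perm = recompute (Listₚ.≡-dec ℕ._≟_ _ _)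

recompute-hooks : ∀ {hs hs′ : List Hook} → .(hs ≡ hs′) → hs ≡ hs′
recompute-hooks = recompute (Listₚ.≡-dec (Productₚ.≡-dec ℕ._≟_ ℕ._≟_) _ _)

recompute-ℕ : ∀ {m n : ℕ} → .(m ≡ n) → m ≡ n
recompute-ℕ = recompute (_ ℕ.≟ _)

IsVHC⇒IsVHCFrom : ∀ π hs → IsVHC π hs → IsVHCFrom π 0 hs
IsVHC⇒IsVHCFrom π hs (srcs , valid , nc) = mkVHCFrom z≤n srcs (All-lookup⁺ hs valid) (AllPairs-lookup⁺ hs nc)

IsVHCFrom⇒IsVHC : ∀ π hs → IsVHCFrom π 0 hs → IsVHC π hs
IsVHCFrom⇒IsVHC π hs (mkVHCFrom _ srcs valid nc) = srcs , All-lookup⁻ valid , AllPairs-lookup⁻ nc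

module _ {π : List ℕ} {N : ℕ} (p : π ↭ oneTo N) (av : Avoids132-231 π) (πN≡N : ent π N ≡ N) where
  private
    open Permutation p
    peak : ∀ i j k → 1 ≤ i → i < j → j < k → k ≤ length π → ent π i < ent π j → ent π k < ent π j → ⊥
    peak = no-peak unique av

    ent≤πN : ∀ i → 1 ≤ i → i ≤ length π → ent π i ≤ ent π N
    ent≤πN i 1≤i i≤ = subst (ent π i ≤_) (sym πN≡N) (proj₂ (ent-bounded i 1≤i (subst (i ≤_) length≡ i≤)))

    crosses-arm : ∀ d j t → IsValidHook π (d , j) → NonCrossing π (d , j) (t , N) → d < t → t < j → t < N →
                  ent π t ≤ ent π j → ⊥
    crosses-arm d j t ((1≤d , d<j , j≤ , _) , _) nc d<t t<j t<N πt≤πj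
      with nc (t , ent π j) (inj₂ (refl , <⇒≤ d<t , <⇒≤ t<j)) (inj₁ (refl , πt≤πj , ent≤πN j (≤-trans 1≤d (<⇒≤ d<j)) j≤))
    ... | inj₁ (e , _) = <-irrefl (cong proj₁ e) t<j
    ... | inj₂ (e , _) = <-irrefl (cong proj₁ e) t<N

  -- If j < t, then j, t, t + 1 or d, j, t is a peak; if t ≤ j, then d, t, j is a peak or the hook from t to
  -- the maximum crosses the arm of the hook (d , j).
  no-descent-hooked-to-max : ∀ d j t → IsValidHook π (d , j) → NonCrossing π (d , j) (t , N) → d < t → t < N → IsDescent π t → ⊥
  no-descent-hooked-to-max d j t ((1≤d , d<j , j≤ , πd<πj) , _) nc d<t t<N t-descent with <-cmp j t
  ... | tri< j<t _ _ with <-cmp (ent π j) (ent π t)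
  ...   | tri< πj<πt _ _ = peak j t (suc t) (≤-trans 1≤d (<⇒≤ d<j)) j<t ≤-refl (≤length t<N) πj<πt t-descent
  ...   | tri≈ _ πj≡πt _ =
    <-irrefl (ent-injective π unique j t (≤-trans 1≤d (<⇒≤ d<j)) j≤ (≤-trans 1≤d (<⇒≤ d<t)) (≤length (<⇒≤ t<N)) πj≡πt) j<t
  ...   | tri> _ _ πt<πj = peak d j t 1≤d d<j j<t (≤length (<⇒≤ t<N)) πd<πj πt<πj
  no-descent-hooked-to-max d j t ((1≤d , d<j , j≤ , πd<πj) , _) nc d<t t<N t-descent | tri≈ _ refl _ =
    peak d j (suc j) 1≤d d<j ≤-refl (≤length t<N) πd<πj t-descent
  no-descent-hooked-to-max d j t v@((1≤d , d<j , j≤ , πd<πj) , _) nc d<t t<N t-descent | tri> _ _ t<j with <-cmp (ent π j) (ent π t)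
  ... | tri< πj<πt _ _ = peak d t j 1≤d d<t t<j j≤ (<-trans πd<πj πj<πt) πj<πt
  ... | tri≈ _ πj≡πt _ = crosses-arm d j t v nc d<t t<j t<N (≤-reflexive (sym πj≡πt))
  ... | tri> _ _ πt<πj = crosses-arm d j t v nc d<t t<j t<N (<⇒≤ πt<πj)

  later-hooks-avoid-max : ∀ k d j hs → IsVHCFrom π k ((d , j) ∷ hs) → All (λ h → proj₂ h ≢ N) hs
  later-hooks-avoid-max k d j hs (mkVHCFrom _ srcs (v ∷ _) (c ∷ _)) =
    All.map (λ { {t , _} ((d<t , ((1≤t , t≤) , t-descent)) , (nc , _)) refl →
                   no-descent-hooked-to-max d j t v nc d<t (subst (t <_) length≡ (descent<length 1≤t t≤)) t-descent })
            (All.zip (All.zip (later , are-descents) , c))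
    where
      descent<length : ∀ {t n} → 1 ≤ t → t ≤ n ∸ 1 → t < n
      descent<length {suc t} {suc n} _ t≤ = s≤s t≤
      sorted : AllPairs _<_ (d ∷ map proj₁ hs)
      sorted = subst (AllPairs _<_) (sym srcs) (AllPairsₚ.drop⁺ k (descents-sorted π))
      later : All (λ h → d < proj₁ h) hs
      later = Allₚ.map⁻ (AllPairs.head sorted)
      are-descents : All (λ h → IsDescentOf π (proj₁ h)) hs
      are-descents = Allₚ.map⁻ (All.tail (subst (All (IsDescentOf π)) (sym srcs) (Allₚ.drop⁺ k (descents-are-descents π))))

MaxFirstConfig : ℕ → ℕ → ℕ → Set
MaxFirstConfig n zero ℓ = ⊥
MaxFirstConfig n (suc k) zero = Config n k 0
MaxFirstConfig n (suc k) (suc ℓ) = ⊥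

module Decomposition (m : ℕ) where

  n′ N : ℕ
  n′ = suc m
  N = suc n′

  perm-∷ʳ : ∀ {π} → π ↭ oneTo n′ → π ++ [ N ] ↭ oneTo N
  perm-∷ʳ {π} p = subst (π ++ [ N ] ↭_) (sym (oneTo-∷ʳ n′)) (++⁺ʳ [ N ] p)

  perm-∷ : ∀ {π} → π ↭ oneTo n′ → N ∷ π ↭ oneTo N
  perm-∷ p = ↭-trans (↭-prep N p) (subst (N ∷ oneTo n′ ↭_) (sym (oneTo-∷ʳ n′)) (∷↭∷ʳ N (oneTo n′)))

  perm-∷ʳ⁻ : ∀ {π} → π ++ [ N ] ↭ oneTo N → π ↭ oneTo n′
  perm-∷ʳ⁻ {π} p = subst₂ _↭_ (++-identityʳ π) (++-identityʳ (oneTo n′))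
                     (drop-mid π (oneTo n′) (subst (π ++ [ N ] ↭_) (oneTo-∷ʳ n′) p))

  perm-∷⁻ : ∀ {π} → N ∷ π ↭ oneTo N → π ↭ oneTo n′
  perm-∷⁻ p = drop-∷ (↭-trans p (↭-sym (subst (N ∷ oneTo n′ ↭_) (sym (oneTo-∷ʳ n′)) (∷↭∷ʳ N (oneTo n′)))))

  below-max : ∀ {π} → π ↭ oneTo n′ → All (_< N) π
  below-max p = All.map (λ (_ , i≤) → s≤s i≤) (Permutation.bounded p)

  descents-∷ʳ-N : ∀ {π} → π ↭ oneTo n′ → descents (π ++ [ N ]) ≡ descents π
  descents-∷ʳ-N {π} p = descents-∷ʳ-max π N (below-max p)

  descents-N-∷ : ∀ {π} → π ↭ oneTo n′ → descents (N ∷ π) ≡ 1 ∷ map suc (descents π)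
  descents-N-∷ {[]} p = ⊥-elim (0≢1+n (Permutation.length≡ p))
  descents-N-∷ {y ∷ π} p = descents-∷-descent N y π (All.head (below-max p))

  tl-∷ʳ-N : ∀ {π} ℓ → π ↭ oneTo n′ → pred ℓ ≤ tl π → ℓ ≤ tl (π ++ [ N ])
  tl-∷ʳ-N zero _ _ = z≤n
  tl-∷ʳ-N {π} (suc ℓ) p t = subst (suc ℓ ≤_) (sym (tl-∷ʳ-fixed π N (cong suc (sym (Permutation.length≡ p))))) (s≤s t)

  tl-∷ʳ-N⁻ : ∀ {π} ℓ → π ↭ oneTo n′ → ℓ ≤ tl (π ++ [ N ]) → pred ℓ ≤ tl π
  tl-∷ʳ-N⁻ zero _ _ = z≤n
  tl-∷ʳ-N⁻ {π} (suc ℓ) p t = ≤-pred (subst (suc ℓ ≤_) (tl-∷ʳ-fixed π N (cong suc (sym (Permutation.length≡ p)))) t)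

  IsVHCFrom-∷ʳ : ∀ {π k hs} → π ↭ oneTo n′ → IsVHCFrom π k hs → IsVHCFrom (π ++ [ N ]) k hs
  IsVHCFrom-∷ʳ {π} {k} p (mkVHCFrom k≤ srcs valid compat) =
    mkVHCFrom (subst (λ D → k ≤ length D) (sym D≡) k≤) (trans srcs (cong (drop k) (sym D≡)))
              (All.map (IsValidHook-∷ʳ⁺ π N) valid) (AllPairs-mapWith valid compat (Compatible-∷ʳ⁺ π N))
    where
      D≡ : descents (π ++ [ N ]) ≡ descents π
      D≡ = descents-∷ʳ-N p

  IsVHCFrom-∷ʳ-hook : ∀ {π k hs} → π ↭ oneTo n′ → IsVHCFrom π (suc k) hs →
                      IsVHCFrom (π ++ [ N ]) k ((hd (drop k (descents π)) , N) ∷ hs)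
  IsVHCFrom-∷ʳ-hook {π} {k} {hs} p (mkVHCFrom k< srcs valid compat) =
    mkVHCFrom (subst (λ D → k ≤ length D) (sym D≡) (≤-trans (n≤1+n k) k<))
              (trans (cong (d ∷_) srcs) (trans (sym (drop-∷-hd k D k<)) (cong (drop k) (sym D≡))))
              (new-valid ∷ All.map (IsValidHook-∷ʳ⁺ π N) valid)
              (new-compatible ∷ AllPairs-mapWith valid compat (Compatible-∷ʳ⁺ π N))
    where
      open Permutation p
      D : List ℕ
      D = descents π
      D≡ : descents (π ++ [ N ]) ≡ D
      D≡ = descents-∷ʳ-N p
      d : ℕ
      d = hd (drop k D)
      P : List ℕ
      P = π ++ [ N ]
      1≤d : 1 ≤ d
      1≤d = proj₁ (proj₁ (All-hd-drop k D k< (descents-are-descents π)))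
      d<N : d < N
      d<N = s≤s (≤-trans (proj₂ (proj₁ (All-hd-drop k D k< (descents-are-descents π))))
                          (≤-trans (m∸n≤m (length π) 1) (≤-reflexive length≡)))
      PN≡N : ent P N ≡ N
      PN≡N = subst (λ z → ent P (suc z) ≡ N) length≡ (ent-∷ʳ-last π N)
      below-PN : ∀ i → 1 ≤ i → i ≤ n′ → ent P i < ent P N
      below-PN i 1≤i i≤ = subst₂ _<_ (sym (ent-∷ʳ π N i (≤length i≤))) (sym PN≡N) (All-ent π (below-max p) i 1≤i (≤length i≤))
      new-valid : IsValidHook P (d , N)
      new-valid = (1≤d , d<N , ≤-reflexive (sym (trans (length-∷ʳ π N) (cong suc length≡))) , below-PN d 1≤d (≤-pred d<N)) ,
                  λ i d<i i<N → below-PN i (≤-trans 1≤d (<⇒≤ d<i)) (≤-pred i<N)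
      later : All (λ h → d < proj₁ h) hs
      later = Allₚ.map⁻ (subst (All (d <_)) (sym srcs) (AllPairs-hd-drop k D k< (descents-sorted π)))
      new-compatible : All (Compatible P (d , N)) hs
      new-compatible = All.zipWith (λ { {i , j} (d<i , ((1≤i , i<j , j≤ , _) , _)) →
                         let πj<πN = below-PN j (≤-trans 1≤i (<⇒≤ i<j)) (subst (j ≤_) length≡ j≤)
                         in (λ q on on′ → ⊥-elim (hooks-disjoint P d N i j q πj<πN d<i on on′)) ,
                            (λ q on on′ → ⊥-elim (hooks-disjoint P d N i j q πj<πN d<i on′ on)) })
                       (later , valid)

  IsVHCFrom-∷ : ∀ {π k hs} → π ↭ oneTo n′ → IsVHCFrom π k hs → IsVHCFrom (N ∷ π) (suc k) (map shiftHook hs)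
  IsVHCFrom-∷ {π} {k} {hs} p (mkVHCFrom k≤ srcs valid compat) =
    mkVHCFrom (subst (λ D → suc k ≤ length D) (sym D≡) (s≤s (subst (k ≤_) (sym (length-map suc (descents π))) k≤)))
              (trans (sources-shiftHook hs) (trans (cong (map suc) srcs)
                (trans (sym (drop-map k (descents π))) (cong (drop (suc k)) (sym D≡)))))
              (Allₚ.map⁺ (All.map (IsValidHook-∷⁺ π N _) valid))
              (AllPairsₚ.map⁺ (AllPairs-mapWith valid compat (Compatible-∷⁺ π N)))
    where
      D≡ : descents (N ∷ π) ≡ 1 ∷ map suc (descents π)
      D≡ = descents-N-∷ p

  module MaxFirst {π : List ℕ} (p : N ∷ π ↭ oneTo N) where

    p′ : π ↭ oneTo n′
    p′ = perm-∷⁻ p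

    tl≡0 : tl (N ∷ π) ≡ 0
    tl≡0 = tl-∷-unfixed π N last-unfixed
      where
        last-unfixed : ent (N ∷ π) (suc (length π)) ≢ suc (length π)
        last-unfixed e rewrite Permutation.length≡ p′ =
          <-irrefl e (s≤s (proj₂ (Permutation.ent-bounded p′ n′ (s≤s z≤n) ≤-refl)))

    no-tail : ∀ {ℓ} → ℓ ≤ tl (N ∷ π) → ℓ ≡ 0
    no-tail t = n≤0⇒n≡0 (subst (_ ≤_) tl≡0 t)

    first-descent-unhooked : ∀ {hs} → ¬ IsVHCFrom (N ∷ π) 0 hs
    first-descent-unhooked {hs} (mkVHCFrom _ srcs valid _) = go hs (trans srcs (descents-N-∷ p′)) valid
      where
        go : ∀ hs → map proj₁ hs ≡ 1 ∷ map suc (descents π) → All (IsValidHook (N ∷ π)) hs → ⊥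
        go ((i , j) ∷ _) srcs (((_ , i<j , j≤ , πi<πj) , _) ∷ _) with ∷-injectiveˡ srcs
        ... | refl = <-irrefl refl (<-≤-trans πi<πj (proj₂ (Permutation.ent-bounded p j (≤-trans (s≤s z≤n) i<j)
                                                              (subst (j ≤_) (Permutation.length≡ p) j≤))))

    module _ {k hs} (v : IsVHCFrom (N ∷ π) (suc k) hs) where
      open IsVHCFrom v

      sources-shifted : map proj₁ hs ≡ map suc (drop k (descents π))
      sources-shifted = trans sources (trans (cong (drop (suc k)) (descents-N-∷ p′)) (drop-map k (descents π)))

      sources≥2 : All (λ h → 2 ≤ proj₁ h) hs
      sources≥2 = Allₚ.map⁻ (subst (All (2 ≤_)) (sym sources-shifted)
                    (Allₚ.map⁺ (All.map (λ ((1≤d , _) , _) → s≤s 1≤d) (Allₚ.drop⁺ k (descents-are-descents π)))))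

      IsVHCFrom-∷⁻ : IsVHCFrom π k (map unshiftHook hs)
      IsVHCFrom-∷⁻ =
        mkVHCFrom (subst (k ≤_) (length-map suc (descents π)) (≤-pred (subst (λ D → suc k ≤ length D) (descents-N-∷ p′) k≤)))
                  (trans (sources-unshiftHook hs) (trans (cong (map pred) sources-shifted) (trans (sym (map-∘ _)) (map-id _))))
                  (Allₚ.map⁺ (All.zipWith (λ (2≤i , vh) → IsValidHook-∷⁻ π N _ 2≤i vh) (sources≥2 , valid)))
                  (AllPairsₚ.map⁺ (AllPairs-mapWith (All.zip (sources≥2 , valid)) compatible
                                     (λ (2≤i , vh) (2≤i′ , vh′) → Compatible-∷⁻ π N 2≤i 2≤i′ vh vh′)))

  module MaxLast {π : List ℕ} (p : π ++ [ N ] ↭ oneTo N) where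

    p′ : π ↭ oneTo n′
    p′ = perm-∷ʳ⁻ p

    PN≡N : ent (π ++ [ N ]) N ≡ N
    PN≡N = subst (λ z → ent (π ++ [ N ]) (suc z) ≡ N) (Permutation.length≡ p′) (ent-∷ʳ-last π N)

    later-hooks-avoid-N : ∀ {k d j hs} → Avoids132-231 (π ++ [ N ]) → IsVHCFrom (π ++ [ N ]) k ((d , j) ∷ hs) →
                          All (λ h → proj₂ h ≢ N) hs
    later-hooks-avoid-N {k} {d} {j} {hs} av = later-hooks-avoid-max p av PN≡N k d j hs

    private
      D≡ : descents (π ++ [ N ]) ≡ descents π
      D≡ = descents-∷ʳ-N p′

      ≤length : ∀ {j} → j ≤ length (π ++ [ N ]) → j ≢ N → j ≤ length π
      ≤length {j} j≤ j≢N with m≤n⇒m<n∨m≡n (subst (j ≤_) (trans (length-∷ʳ π N) (cong suc (Permutation.length≡ p′))) j≤)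
      ... | inj₁ (s≤s j≤n′) = subst (j ≤_) (sym (Permutation.length≡ p′)) j≤n′
      ... | inj₂ j≡N = ⊥-elim (j≢N j≡N)

      restrict : ∀ {hs} → All (IsValidHook (π ++ [ N ])) hs → AllPairs (Compatible (π ++ [ N ])) hs →
                 All (λ h → proj₂ h ≢ N) hs → All (IsValidHook π) hs × AllPairs (Compatible π) hs
      restrict valid compat avoid =
        All.zipWith (λ (vh@((_ , _ , j≤ , _) , _) , j≢N) → IsValidHook-∷ʳ⁻ π N (≤length j≤ j≢N) vh)
                    (valid , avoid) ,
        AllPairs-mapWith (All.zip (valid , avoid)) compat
          (λ { (vh@((_ , _ , j≤ , _) , _) , j≢N) (vh′@((_ , _ , j′≤ , _) , _) , j′≢N) →
                 Compatible-∷ʳ⁻ π N (≤length j≤ j≢N) (≤length j′≤ j′≢N) vh vh′ })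

    IsVHCFrom-∷ʳ⁻ : ∀ {k hs} → IsVHCFrom (π ++ [ N ]) k hs → All (λ h → proj₂ h ≢ N) hs → IsVHCFrom π k hs
    IsVHCFrom-∷ʳ⁻ {k} (mkVHCFrom k≤ srcs valid compat) avoid =
      mkVHCFrom (subst (λ D → k ≤ length D) D≡ k≤) (trans srcs (cong (drop k) D≡))
                (proj₁ (restrict valid compat avoid)) (proj₂ (restrict valid compat avoid))

    private
      sources′ : ∀ {k d j hs} → IsVHCFrom (π ++ [ N ]) k ((d , j) ∷ hs) → drop k (descents π) ≡ d ∷ map proj₁ hs
      sources′ {k} v = sym (trans (IsVHCFrom.sources v) (cong (drop k) D≡))

    IsVHCFrom-∷ʳ-hook⁻ : ∀ {k d j hs} → IsVHCFrom (π ++ [ N ]) k ((d , j) ∷ hs) → All (λ h → proj₂ h ≢ N) hs →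
                         IsVHCFrom π (suc k) hs
    IsVHCFrom-∷ʳ-hook⁻ {k} v@(mkVHCFrom _ _ (_ ∷ valid) (_ ∷ compat)) avoid
      with drop-≡-∷ k (descents π) (sources′ v)
    ... | k< , srcs , _ = mkVHCFrom k< (sym srcs) (proj₁ (restrict valid compat avoid)) (proj₂ (restrict valid compat avoid))

    hooked-descent : ∀ {k d j hs} → IsVHCFrom (π ++ [ N ]) k ((d , j) ∷ hs) → hd (drop k (descents π)) ≡ d
    hooked-descent {k} v = proj₂ (proj₂ (drop-≡-∷ k (descents π) (sources′ v)))

  Pieces : ℕ → ℕ → Set
  Pieces k ℓ = Config n′ k (pred ℓ) ⊎ (Config n′ (suc k) (pred ℓ) ⊎ MaxFirstConfig n′ k ℓ)

  join : ∀ {k ℓ} → Pieces k ℓ → Config N k ℓ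
  join {k} {ℓ} (inj₁ (config π hs p a t v)) =
    config (π ++ [ N ]) hs (perm-∷ʳ p) (avoids-∷ʳ⁺ π N a (below-max p)) (tl-∷ʳ-N ℓ p t) (IsVHCFrom-∷ʳ p v)
  join {k} {ℓ} (inj₂ (inj₁ (config π hs p a t v))) =
    config (π ++ [ N ]) ((hd (drop k (descents π)) , N) ∷ hs) (perm-∷ʳ p) (avoids-∷ʳ⁺ π N a (below-max p)) (tl-∷ʳ-N ℓ p t)
           (IsVHCFrom-∷ʳ-hook p v)
  join {suc k} {zero} (inj₂ (inj₂ (config π hs p a t v))) =
    config (N ∷ π) (map shiftHook hs) (perm-∷ p) (avoids-∷⁺ π N a (below-max p)) z≤n (IsVHCFrom-∷ p v)

  private
    EndsAtN : List Hook → Set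
    EndsAtN [] = ⊥
    EndsAtN ((_ , j) ∷ _) = j ≡ N

    endsAtN? : ∀ hs → Dec (EndsAtN hs)
    endsAtN? [] = no (λ ())
    endsAtN? ((_ , j) ∷ _) = j ℕ.≟ N

    split-max-first : ∀ {k ℓ} π hs → .(N ∷ π ↭ oneTo N) → .(Avoids132-231 (N ∷ π)) → .(ℓ ≤ tl (N ∷ π)) →
                      .(IsVHCFrom (N ∷ π) k hs) → Pieces k ℓ
    split-max-first {zero} π hs p a t v = ⊥-elim-irr (MaxFirst.first-descent-unhooked p v)
    split-max-first {suc k} {suc ℓ} π hs p a t v = ⊥-elim-irr (0≢1+n (sym (MaxFirst.no-tail p t)))
    split-max-first {suc k} {zero} π hs p a t v =
      inj₂ (inj₂ (config π (map unshiftHook hs) (MaxFirst.p′ p) (avoids-∷⁻ π N a) z≤n (MaxFirst.IsVHCFrom-∷⁻ p v)))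

    none-end-at-N : ∀ {k} π hs → π ++ [ N ] ↭ oneTo N → Avoids132-231 (π ++ [ N ]) → IsVHCFrom (π ++ [ N ]) k hs →
                    ¬ EndsAtN hs → All (λ h → proj₂ h ≢ N) hs
    none-end-at-N π [] p a v _ = []
    none-end-at-N π ((d , j) ∷ hs) p a v j≢N = j≢N ∷ MaxLast.later-hooks-avoid-N p a v

    split-max-last : ∀ {k ℓ} π hs → .(π ++ [ N ] ↭ oneTo N) → .(Avoids132-231 (π ++ [ N ])) → .(ℓ ≤ tl (π ++ [ N ])) →
                     .(IsVHCFrom (π ++ [ N ]) k hs) → Dec (EndsAtN hs) → Pieces k ℓ
    split-max-last {k} {ℓ} π ((d , j) ∷ hs) p a t v (yes _) =
      inj₂ (inj₁ (config π hs (MaxLast.p′ p) (avoids-∷ʳ⁻ π N a) (tl-∷ʳ-N⁻ ℓ (MaxLast.p′ p) t)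
                    (MaxLast.IsVHCFrom-∷ʳ-hook⁻ p v (MaxLast.later-hooks-avoid-N p a v))))
    split-max-last {k} {ℓ} π hs p a t v (no ¬ends) =
      inj₁ (config π hs (MaxLast.p′ p) (avoids-∷ʳ⁻ π N a) (tl-∷ʳ-N⁻ ℓ (MaxLast.p′ p) t)
              (MaxLast.IsVHCFrom-∷ʳ⁻ p v (none-end-at-N π hs p a v ¬ends)))

    max-last : ∀ y π → .(y ∷ π ↭ oneTo N) → .(Avoids132-231 (y ∷ π)) → y ≢ N → y ∷ π ≡ dropLast (y ∷ π) ++ [ N ]
    max-last y π p a y≢N = recompute-perm (last-is-max p (max-first-or-last p a))
      where
        last-is-max : y ∷ π ↭ oneTo N → ent (y ∷ π) 1 ≡ N ⊎ ent (y ∷ π) N ≡ N → y ∷ π ≡ dropLast (y ∷ π) ++ [ N ]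
        last-is-max _ (inj₁ y≡N) = ⊥-elim (y≢N y≡N)
        last-is-max p (inj₂ last≡N) = trans (dropLast-++-last y π)
          (cong (λ z → dropLast (y ∷ π) ++ [ z ]) (trans (cong (ent (y ∷ π)) (Permutation.length≡ p)) last≡N))

    split-nonempty : ∀ {k ℓ} y π hs → .(y ∷ π ↭ oneTo N) → .(Avoids132-231 (y ∷ π)) → .(ℓ ≤ tl (y ∷ π)) →
                     .(IsVHCFrom (y ∷ π) k hs) → Dec (y ≡ N) → Pieces k ℓ
    split-nonempty y π hs p a t v (yes refl) = split-max-first π hs p a t v
    split-nonempty {k} {ℓ} y π hs p a t v (no y≢N) =
      split-max-last (dropLast (y ∷ π)) hs (subst (_↭ oneTo N) eq p) (subst Avoids132-231 eq a)
        (subst (λ σ → ℓ ≤ tl σ) eq t) (subst (λ σ → IsVHCFrom σ k hs) eq v) (endsAtN? hs)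
      where
        eq : y ∷ π ≡ dropLast (y ∷ π) ++ [ N ]
        eq = max-last y π p a y≢N

  split : ∀ {k ℓ} → Config N k ℓ → Pieces k ℓ
  split (config [] hs p a t v) = ⊥-elim-irr (0≢1+n (Permutation.length≡ p))
  split (config (y ∷ π) hs p a t v) = split-nonempty y π hs p a t v (y ℕ.≟ N)

  split-join : ∀ {k ℓ} x → split {k} {ℓ} (join x) ≡ x
  split-join (inj₁ (config [] hs p a t v)) = ⊥-elim-irr (0≢1+n (Permutation.length≡ p))
  split-join (inj₁ (config (y ∷ π) [] p a t v)) with y ℕ.≟ N
  ... | yes y≡N = ⊥-elim-irr (<-irrefl y≡N (All.head (below-max p)))
  ... | no _ = cong inj₁ (config-≡ (dropLast-∷ʳ (y ∷ π) N) refl)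
  split-join (inj₁ (config (y ∷ π) ((d , j) ∷ hs) p a t v)) with y ℕ.≟ N
  ... | yes y≡N = ⊥-elim-irr (<-irrefl y≡N (All.head (below-max p)))
  ... | no _ with j ℕ.≟ N
  ...   | yes j≡N = ⊥-elim-irr (<-irrefl j≡N (s≤s (subst (j ≤_) (Permutation.length≡ p)
                                                   (proj₁ (proj₂ (proj₂ (proj₁ (All.head (IsVHCFrom.valid v)))))))))
  ...   | no _ = cong inj₁ (config-≡ (dropLast-∷ʳ (y ∷ π) N) refl)
  split-join (inj₂ (inj₁ (config [] hs p a t v))) = ⊥-elim-irr (0≢1+n (Permutation.length≡ p))
  split-join (inj₂ (inj₁ (config (y ∷ π) hs p a t v))) with y ℕ.≟ N
  ... | yes y≡N = ⊥-elim-irr (<-irrefl y≡N (All.head (below-max p)))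
  ... | no _ with N ℕ.≟ N
  ...   | yes _ = cong (λ c → inj₂ (inj₁ c)) (config-≡ (dropLast-∷ʳ (y ∷ π) N) refl)
  ...   | no N≢N = ⊥-elim (N≢N refl)
  split-join {suc k} {zero} (inj₂ (inj₂ (config π hs p a t v))) with N ℕ.≟ N
  ... | yes refl = cong (λ c → inj₂ (inj₂ c)) (config-≡ refl (unshiftHook-shiftHook hs))
  ... | no N≢N = ⊥-elim (N≢N refl)

  private
    join-split-max-first : ∀ {k ℓ} π hs .(p : N ∷ π ↭ oneTo N) .(a : Avoids132-231 (N ∷ π)) .(t : ℓ ≤ tl (N ∷ π))
                           .(v : IsVHCFrom (N ∷ π) k hs) → join (split-max-first π hs p a t v) ≡ config (N ∷ π) hs p a t v
    join-split-max-first {zero} π hs p a t v = ⊥-elim-irr (MaxFirst.first-descent-unhooked p v)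
    join-split-max-first {suc k} {suc ℓ} π hs p a t v = ⊥-elim-irr (0≢1+n (sym (MaxFirst.no-tail p t)))
    join-split-max-first {suc k} {zero} π hs p a t v =
      config-≡ refl (recompute-hooks (shiftHook-unshiftHook hs (IsVHCFrom.valid v)))

    join-split-max-last : ∀ {k ℓ} y π hs .(p : y ∷ π ↭ oneTo N) .(a : Avoids132-231 (y ∷ π)) .(t : ℓ ≤ tl (y ∷ π))
                          .(v : IsVHCFrom (y ∷ π) k hs) (y≢N : y ≢ N) →
                          join (split-nonempty y π hs p a t v (no y≢N)) ≡ config (y ∷ π) hs p a t v
    join-split-max-last y π [] p a t v y≢N = config-≡ (sym (max-last y π p a y≢N)) refl
    join-split-max-last {k} y π ((d , j) ∷ hs) p a t v y≢N with j ℕ.≟ N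
    ... | yes refl = config-≡ (sym eq)
                       (cong (λ d′ → (d′ , N) ∷ hs)
                             (recompute-ℕ (MaxLast.hooked-descent (subst (_↭ oneTo N) eq p) (subst (λ σ → IsVHCFrom σ k ((d , N) ∷ hs)) eq v))))
      where
        eq : y ∷ π ≡ dropLast (y ∷ π) ++ [ N ]
        eq = max-last y π p a y≢N
    ... | no _ = config-≡ (sym (max-last y π p a y≢N)) refl

  join-split : ∀ {k ℓ} c → join {k} {ℓ} (split c) ≡ c
  join-split (config [] hs p a t v) = ⊥-elim-irr (0≢1+n (Permutation.length≡ p))
  join-split (config (y ∷ π) hs p a t v) with y ℕ.≟ N
  ... | yes refl = join-split-max-first π hs p a t v
  ... | no y≢N = join-split-max-last y π hs p a t v y≢N

-- Counting

mutual
  count : ℕ → ℕ → ℕ → ℕ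
  count zero zero zero = 1
  count zero zero (suc _) = 0
  count zero (suc _) _ = 0
  count (suc zero) zero zero = 1
  count (suc zero) zero (suc zero) = 1
  count (suc zero) zero (suc (suc _)) = 0
  count (suc zero) (suc _) _ = 0
  count (suc (suc m)) k ℓ = count (suc m) k (pred ℓ) ℕ.+ (count (suc m) (suc k) (pred ℓ) ℕ.+ countMaxFirst (suc m) k ℓ)

  countMaxFirst : ℕ → ℕ → ℕ → ℕ
  countMaxFirst n zero ℓ = 0
  countMaxFirst n (suc k) zero = count n k 0
  countMaxFirst n (suc k) (suc ℓ) = 0

↔Fin0 : ∀ {A : Set} → ¬ A → A ↔ Fin 0
↔Fin0 ¬a = mk↔ₛ′ (λ a → ⊥-elim (¬a a)) (λ ()) (λ ()) (λ a → ⊥-elim (¬a a))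

↔Fin1 : ∀ {A : Set} (a₀ : A) → (∀ a → a ≡ a₀) → A ↔ Fin 1
↔Fin1 a₀ unique = mk↔ₛ′ (λ _ → zero) (λ _ → a₀) (λ { zero → refl }) (λ a → sym (unique a))

perm-small : ∀ {m π} → m ≤ 1 → π ↭ oneTo m → π ≡ oneTo m
perm-small {zero} _ p = ↭-empty-inv p
perm-small {suc zero} _ p = ↭-singleton-inv p
perm-small {suc (suc _)} (s≤s ())

descents-small : ∀ {m} → m ≤ 1 → descents (oneTo m) ≡ []
descents-small {zero} _ = refl
descents-small {suc zero} _ = refl
descents-small {suc (suc _)} (s≤s ())

tl-small : ∀ {m} → m ≤ 1 → tl (oneTo m) ≡ m
tl-small {zero} _ = refl
tl-small {suc zero} _ = refl
tl-small {suc (suc _)} (s≤s ())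

module Small {m : ℕ} (m≤1 : m ≤ 1) where
  private
    avoids : Avoids132-231 (oneTo m)
    avoids = (λ (_ , _ , _ , 1≤i , i<j , j<k , k≤ , _) → short 1≤i i<j j<k k≤) ,
             (λ (_ , _ , _ , 1≤i , i<j , j<k , k≤ , _) → short 1≤i i<j j<k k≤)
      where
        short : ∀ {i j k} → 1 ≤ i → i < j → j < k → k ≤ length (oneTo m) → ⊥
        short 1≤i i<j j<k k≤ = <-irrefl refl (≤-trans (<-trans (≤-<-trans 1≤i i<j) j<k)
                                                       (≤-trans k≤ (≤-trans (≤-reflexive (Permutation.length≡ ↭-refl)) m≤1)))

    no-descents-of : ∀ {π} → π ↭ oneTo m → descents π ≡ []
    no-descents-of p = trans (cong descents (perm-small m≤1 p)) (descents-small m≤1)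

    hooks-none : ∀ {π k hs} → π ↭ oneTo m → IsVHCFrom π k hs → hs ≡ []
    hooks-none {k = k} p v = empty (trans (IsVHCFrom.sources v) (trans (cong (drop k) (no-descents-of p)) (drop-[] k)))
      where
        empty : ∀ {hs : List Hook} → map proj₁ hs ≡ [] → hs ≡ []
        empty {[]} _ = refl

  identity-config : ∀ {ℓ} → ℓ ≤ m → Config m 0 ℓ
  identity-config ℓ≤m = config (oneTo m) [] ↭-refl avoids (subst (_ ≤_) (sym (tl-small m≤1)) ℓ≤m) (mkVHCFrom z≤n (sym (descents-small m≤1)) [] [])

  only-identity-config : ∀ {ℓ} (ℓ≤m : ℓ ≤ m) (c : Config m 0 ℓ) → c ≡ identity-config ℓ≤m
  only-identity-config ℓ≤m (config π hs p a t v) = config-≡ (recompute-perm (perm-small m≤1 p)) (recompute-hooks (hooks-none p v))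

  no-config-hooking-later : ∀ {k ℓ} → ¬ Config m (suc k) ℓ
  no-config-hooking-later {k} (config π hs p a t v) = ⊥-elim-irr (impossible p (IsVHCFrom.k≤ v))
    where
      impossible : π ↭ oneTo m → suc k ≤ length (descents π) → ⊥
      impossible p k< with subst (λ D → suc k ≤ length D) (no-descents-of p) k<
      ... | ()

  no-config-long-tail : ∀ {ℓ} → m < ℓ → ¬ Config m 0 ℓ
  no-config-long-tail {ℓ} m<ℓ (config π hs p a t v) = ⊥-elim-irr (impossible p t)
    where
      impossible : π ↭ oneTo m → ℓ ≤ tl π → ⊥
      impossible p t = <⇒≱ m<ℓ (subst (ℓ ≤_) (trans (cong tl (perm-small m≤1 p)) (tl-small m≤1)) t)

Config↔Fin-small : ∀ m k ℓ → m ≤ 1 → Config m k ℓ ↔ Fin (count m k ℓ)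
Config↔Fin-small zero zero zero m≤1 = ↔Fin1 _ (Small.only-identity-config m≤1 z≤n)
Config↔Fin-small zero zero (suc ℓ) m≤1 = ↔Fin0 (Small.no-config-long-tail m≤1 (s≤s z≤n))
Config↔Fin-small zero (suc k) ℓ m≤1 = ↔Fin0 (Small.no-config-hooking-later m≤1)
Config↔Fin-small (suc zero) zero zero m≤1 = ↔Fin1 _ (Small.only-identity-config m≤1 z≤n)
Config↔Fin-small (suc zero) zero (suc zero) m≤1 = ↔Fin1 _ (Small.only-identity-config m≤1 ≤-refl)
Config↔Fin-small (suc zero) zero (suc (suc ℓ)) m≤1 = ↔Fin0 (Small.no-config-long-tail m≤1 (s≤s (s≤s z≤n)))
Config↔Fin-small (suc zero) (suc k) ℓ m≤1 = ↔Fin0 (Small.no-config-hooking-later m≤1)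
Config↔Fin-small (suc (suc _)) _ _ (s≤s ())

mutual
  Config↔Fin : ∀ m k ℓ → Config m k ℓ ↔ Fin (count m k ℓ)
  Config↔Fin zero k ℓ = Config↔Fin-small zero k ℓ z≤n
  Config↔Fin (suc zero) k ℓ = Config↔Fin-small (suc zero) k ℓ ≤-refl
  Config↔Fin (suc (suc m)) k ℓ =
    ↔-trans decompose
      (↔-trans (Config↔Fin (suc m) k (pred ℓ) ⊎-↔ (Config↔Fin (suc m) (suc k) (pred ℓ) ⊎-↔ MaxFirstConfig↔Fin (suc m) k ℓ))
        (↔-trans (↔-refl ⊎-↔ ↔-sym (+↔⊎ {count (suc m) (suc k) (pred ℓ)}))
                 (↔-sym (+↔⊎ {count (suc m) k (pred ℓ)}))))
    where
      open Decomposition m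
      decompose : Config N k ℓ ↔ Pieces k ℓ
      decompose = mk↔ₛ′ split join split-join join-split

  MaxFirstConfig↔Fin : ∀ n k ℓ → MaxFirstConfig n k ℓ ↔ Fin (countMaxFirst n k ℓ)
  MaxFirstConfig↔Fin n zero ℓ = ↔Fin0 (λ ())
  MaxFirstConfig↔Fin n (suc k) zero = Config↔Fin n k 0
  MaxFirstConfig↔Fin n (suc k) (suc ℓ) = ↔Fin0 (λ ())

VHCObj↔Config : ∀ n ℓ → VHCObj n ℓ ↔ Config (n ℕ.+ ℓ) 0 ℓ
VHCObj↔Config n ℓ = mk↔ₛ′ (λ (vhc π hs p a t v) → config π hs p a t (IsVHC⇒IsVHCFrom π hs v))
                          (λ (config π hs p a t v) → vhc π hs p a t (IsVHCFrom⇒IsVHC π hs v)) (λ _ → refl) (λ _ → refl)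

count-VHC : (A : ℕ → ℕ → ℕ) → (∀ n ℓ → Fin (A n ℓ) ↔ VHCObj n ℓ) → ∀ n ℓ → A n ℓ ≡ count (n ℕ.+ ℓ) 0 ℓ
count-VHC A A↔ n ℓ = ↔⇒≡ (↔-trans (A↔ n ℓ) (↔-trans (VHCObj↔Config n ℓ) (Config↔Fin (n ℕ.+ ℓ) 0 ℓ)))

-- Convolution of integer sequences

infixl 7 _⋆_

_⋆_ : (ℕ → ℤ) → (ℕ → ℤ) → ℕ → ℤ
(f ⋆ g) zero = f 0 * g 0
(f ⋆ g) (suc n) = (f ⋆ (λ i → g (suc i))) n + f (suc n) * g 0

shift : (ℕ → ℤ) → ℕ → ℤ
shift f zero = + 0
shift f (suc i) = f i

δ₀ δ₁ : ℕ → ℤ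
δ₀ zero = + 1
δ₀ (suc _) = + 0
δ₁ (suc zero) = + 1
δ₁ _ = + 0

⋆-cong-≤ : ∀ n {f f′ g g′ : ℕ → ℤ} → (∀ i → i ≤ n → f i ≡ f′ i) → (∀ i → i ≤ n → g i ≡ g′ i) →
           (f ⋆ g) n ≡ (f′ ⋆ g′) n
⋆-cong-≤ zero f≡ g≡ = cong₂ _*_ (f≡ 0 z≤n) (g≡ 0 z≤n)
⋆-cong-≤ (suc n) f≡ g≡ = cong₂ _+_ (⋆-cong-≤ n (λ i i≤ → f≡ i (m≤n⇒m≤1+n i≤)) (λ i i≤ → g≡ (suc i) (s≤s i≤)))
                                    (cong₂ _*_ (f≡ (suc n) ≤-refl) (g≡ 0 z≤n))

⋆-cong : ∀ {f f′ g g′ : ℕ → ℤ} → (∀ i → f i ≡ f′ i) → (∀ i → g i ≡ g′ i) → ∀ n → (f ⋆ g) n ≡ (f′ ⋆ g′) n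
⋆-cong f≡ g≡ n = ⋆-cong-≤ n (λ i _ → f≡ i) (λ i _ → g≡ i)

⋆-zeroʳ : ∀ f n → (f ⋆ (λ _ → + 0)) n ≡ + 0
⋆-zeroʳ f zero = ℤₚ.*-zeroʳ (f 0)
⋆-zeroʳ f (suc n) = cong₂ _+_ (⋆-zeroʳ f n) (ℤₚ.*-zeroʳ (f (suc n)))

⋆-distribˡ-+ : ∀ f g h n → (f ⋆ (λ i → g i + h i)) n ≡ (f ⋆ g) n + (f ⋆ h) n
⋆-distribˡ-+ f g h zero = ℤₚ.*-distribˡ-+ (f 0) (g 0) (h 0)
⋆-distribˡ-+ f g h (suc n) rewrite ⋆-distribˡ-+ f (λ i → g (suc i)) (λ i → h (suc i)) n =
  interchange ((f ⋆ (λ i → g (suc i))) n) ((f ⋆ (λ i → h (suc i))) n) (f (suc n)) (g 0) (h 0)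
  where
    interchange : ∀ a b c d e → a + b + c * (d + e) ≡ a + c * d + (b + c * e)
    interchange = solve-∀

⋆-*ʳ : ∀ f g c n → (f ⋆ (λ i → c * g i)) n ≡ c * (f ⋆ g) n
⋆-*ʳ f g c zero = commute (f 0) c (g 0)
  where
    commute : ∀ a b d → a * (b * d) ≡ b * (a * d)
    commute = solve-∀
⋆-*ʳ f g c (suc n) rewrite ⋆-*ʳ f (λ i → g (suc i)) c n = factor ((f ⋆ (λ i → g (suc i))) n) c (f (suc n)) (g 0)
  where
    factor : ∀ a b d e → b * a + d * (b * e) ≡ b * (a + d * e)
    factor = solve-∀

⋆-unfoldˡ : ∀ f g n → (f ⋆ g) (suc n) ≡ f 0 * g (suc n) + ((λ i → f (suc i)) ⋆ g) n
⋆-unfoldˡ f g zero = refl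
⋆-unfoldˡ f g (suc n) rewrite ⋆-unfoldˡ f (λ i → g (suc i)) n =
  ℤₚ.+-assoc (f 0 * g (suc (suc n))) (((λ i → f (suc i)) ⋆ (λ i → g (suc i))) n) (f (suc (suc n)) * g 0)

⋆-comm : ∀ f g n → (f ⋆ g) n ≡ (g ⋆ f) n
⋆-comm f g zero = ℤₚ.*-comm (f 0) (g 0)
⋆-comm f g (suc n) = begin
  (f ⋆ g) (suc n)                                 ≡⟨ ⋆-unfoldˡ f g n ⟩
  f 0 * g (suc n) + ((λ i → f (suc i)) ⋆ g) n     ≡⟨ cong (λ z → f 0 * g (suc n) + z) (⋆-comm (λ i → f (suc i)) g n) ⟩
  f 0 * g (suc n) + (g ⋆ (λ i → f (suc i))) n     ≡⟨ swap (f 0) (g (suc n)) ((g ⋆ (λ i → f (suc i))) n) ⟩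
  (g ⋆ f) (suc n)                                 ∎
  where
    swap : ∀ a b c → a * b + c ≡ c + b * a
    swap = solve-∀

⋆-distribʳ-+ : ∀ f g h n → ((λ i → f i + g i) ⋆ h) n ≡ (f ⋆ h) n + (g ⋆ h) n
⋆-distribʳ-+ f g h n = trans (⋆-comm _ h n) (trans (⋆-distribˡ-+ h f g n) (cong₂ _+_ (⋆-comm h f n) (⋆-comm h g n)))

⋆-*ˡ : ∀ c f g n → ((λ i → c * f i) ⋆ g) n ≡ c * (f ⋆ g) n
⋆-*ˡ c f g n = trans (⋆-comm _ g n) (trans (⋆-*ʳ g f c n) (cong (c *_) (⋆-comm g f n)))

⋆-negʳ : ∀ f g n → (f ⋆ (λ i → - g i)) n ≡ - (f ⋆ g) n
⋆-negʳ f g n = trans (⋆-cong (λ _ → refl) (λ i → sym (ℤₚ.-1*i≡-i (g i))) n) (trans (⋆-*ʳ f g (- + 1) n) (ℤₚ.-1*i≡-i _))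

⋆-negˡ : ∀ f g n → ((λ i → - f i) ⋆ g) n ≡ - (f ⋆ g) n
⋆-negˡ f g n = trans (⋆-comm _ g n) (trans (⋆-negʳ g f n) (cong -_ (⋆-comm g f n)))

⋆-assoc : ∀ f g h n → ((f ⋆ g) ⋆ h) n ≡ (f ⋆ (g ⋆ h)) n
⋆-assoc f g h zero = ℤₚ.*-assoc (f 0) (g 0) (h 0)
⋆-assoc f g h (suc n) = begin
    ((f ⋆ g) ⋆ h′) n + (f ⋆ g) (suc n) * h 0
      ≡⟨ cong (_+ (f ⋆ g) (suc n) * h 0) (⋆-assoc f g h′ n) ⟩
    (f ⋆ (g ⋆ h′)) n + ((f ⋆ g′) n + f (suc n) * g 0) * h 0
      ≡⟨ expand ((f ⋆ (g ⋆ h′)) n) ((f ⋆ g′) n) (f (suc n)) (g 0) (h 0) ⟩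
    (f ⋆ (g ⋆ h′)) n + h 0 * (f ⋆ g′) n + f (suc n) * (g 0 * h 0)
      ≡⟨ cong (λ z → (f ⋆ (g ⋆ h′)) n + z + f (suc n) * (g 0 * h 0)) (sym (⋆-*ʳ f g′ (h 0) n)) ⟩
    (f ⋆ (g ⋆ h′)) n + (f ⋆ (λ i → h 0 * g′ i)) n + f (suc n) * (g 0 * h 0)
      ≡⟨ cong (_+ f (suc n) * (g 0 * h 0)) (sym (⋆-distribˡ-+ f (g ⋆ h′) (λ i → h 0 * g′ i) n)) ⟩
    (f ⋆ (λ i → (g ⋆ h′) i + h 0 * g′ i)) n + f (suc n) * (g 0 * h 0)
      ≡⟨ cong (_+ f (suc n) * (g 0 * h 0)) (⋆-cong (λ _ → refl) (λ i → cong (λ z → (g ⋆ h′) i + z) (ℤₚ.*-comm (h 0) (g′ i))) n) ⟩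
    (f ⋆ (λ i → (g ⋆ h) (suc i))) n + f (suc n) * (g 0 * h 0) ∎
  where
    h′ g′ : ℕ → ℤ
    h′ i = h (suc i)
    g′ i = g (suc i)
    expand : ∀ a b c d e → a + (b + c * d) * e ≡ a + e * b + c * (d * e)
    expand = solve-∀

⋆-shiftʳ-zero : ∀ f g → (f ⋆ shift g) 0 ≡ + 0
⋆-shiftʳ-zero f g = ℤₚ.*-zeroʳ (f 0)

⋆-shiftʳ : ∀ f g n → (f ⋆ shift g) (suc n) ≡ (f ⋆ g) n
⋆-shiftʳ f g n = trans (cong (λ z → (f ⋆ g) n + z) (ℤₚ.*-zeroʳ (f (suc n)))) (ℤₚ.+-identityʳ _)

⋆-shiftˡ : ∀ f g n → (shift f ⋆ g) (suc n) ≡ (f ⋆ g) n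
⋆-shiftˡ f g n = trans (⋆-comm (shift f) g (suc n)) (trans (⋆-shiftʳ g f n) (⋆-comm g f n))

⋆-δ₀ʳ : ∀ f n → (f ⋆ δ₀) n ≡ f n
⋆-δ₀ʳ f zero = ℤₚ.*-identityʳ (f 0)
⋆-δ₀ʳ f (suc n) = trans (cong₂ _+_ (⋆-zeroʳ f n) (ℤₚ.*-identityʳ (f (suc n)))) (ℤₚ.+-identityˡ _)

⋆-δ₀ˡ : ∀ f n → (δ₀ ⋆ f) n ≡ f n
⋆-δ₀ˡ f n = trans (⋆-comm δ₀ f n) (⋆-δ₀ʳ f n)

⋆-δ₁ʳ : ∀ f n → (f ⋆ δ₁) n ≡ shift f n
⋆-δ₁ʳ f zero = ℤₚ.*-zeroʳ (f 0)
⋆-δ₁ʳ f (suc n) = trans (⋆-cong (λ _ → refl) δ₁∘suc (suc n)) (trans (⋆-shiftʳ f δ₀ n) (⋆-δ₀ʳ f n))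
  where
    δ₁∘suc : ∀ i → δ₁ i ≡ shift δ₀ i
    δ₁∘suc zero = refl
    δ₁∘suc (suc zero) = refl
    δ₁∘suc (suc (suc i)) = refl

sumTo-cong-≤ : ∀ n {f g : ℕ → ℤ} → (∀ i → i ≤ n → f i ≡ g i) → sumTo n f ≡ sumTo n g
sumTo-cong-≤ zero f≡g = f≡g 0 z≤n
sumTo-cong-≤ (suc n) f≡g = cong₂ _+_ (sumTo-cong-≤ n (λ i i≤ → f≡g i (m≤n⇒m≤1+n i≤))) (f≡g (suc n) ≤-refl)

sumTo-⋆ : ∀ f g n → sumTo n (λ i → f i * g (n ∸ i)) ≡ (f ⋆ g) n
sumTo-⋆ f g zero = refl
sumTo-⋆ f g (suc n) = cong₂ _+_
  (trans (sumTo-cong-≤ n (λ i i≤ → cong (λ k → f i * g k) (+-∸-assoc 1 i≤))) (sumTo-⋆ f (λ i → g (suc i)) n))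
  (cong (λ k → f (suc n) * g k) (n∸n≡0 n))

-- Generating functions

C : ℕ → ℕ → ℕ → ℤ
C k t r = + count (suc (t ℕ.+ r)) k t

C-suc-tail : ∀ k t r → C k (suc t) r ≡ C k t r + C (suc k) t r
C-suc-tail zero t r = cong +_ (cong (count (suc (t ℕ.+ r)) zero t ℕ.+_) (+-identityʳ _))
C-suc-tail (suc k) t r = cong +_ (cong (count (suc (t ℕ.+ r)) (suc k) t ℕ.+_) (+-identityʳ _))

C↓ : ℕ → ℕ → ℤ
C↓ zero r = + 0
C↓ (suc k) r = C k 0 r

C-suc-size : ∀ k r → C k 0 (suc r) ≡ C k 0 r + C (suc k) 0 r + C↓ k r
C-suc-size zero r = cong +_ (sym (+-assoc (count (suc r) 0 0) (count (suc r) 1 0) 0))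
C-suc-size (suc k) r = cong +_ (sym (+-assoc (count (suc r) (suc k) 0) (count (suc r) (suc (suc k)) 0) (count (suc r) k 0)))

C-size-one : ∀ k t → C (suc k) t 0 ≡ + 0
C-size-one k zero = refl
C-size-one k (suc t) = trans (C-suc-tail (suc k) t 0) (cong₂ _+_ (C-size-one k t) (C-size-one (suc k) t))

C-hooked₀ : ∀ r k → C (suc k) 0 (suc r) ≡ (C 0 0 ⋆ C k 0) r
C-hooked₀ zero zero = refl
C-hooked₀ zero (suc k) = refl
C-hooked₀ (suc r) k = begin
    C (suc k) 0 (suc (suc r))
      ≡⟨ C-suc-size (suc k) (suc r) ⟩
    C (suc k) 0 (suc r) + C (suc (suc k)) 0 (suc r) + C k 0 (suc r)
      ≡⟨ cong₂ (λ a b → a + b + C k 0 (suc r)) (C-hooked₀ r k) (C-hooked₀ r (suc k)) ⟩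
    (C₀ ⋆ C k 0) r + (C₀ ⋆ C (suc k) 0) r + C k 0 (suc r)
      ≡⟨ cong (λ z → (C₀ ⋆ C k 0) r + (C₀ ⋆ C (suc k) 0) r + z) (correction k) ⟩
    (C₀ ⋆ C k 0) r + (C₀ ⋆ C (suc k) 0) r + ((C₀ ⋆ C↓ k) r + C₀ (suc r) * C k 0 0)
      ≡⟨ regroup ((C₀ ⋆ C k 0) r) ((C₀ ⋆ C (suc k) 0) r) ((C₀ ⋆ C↓ k) r) (C₀ (suc r) * C k 0 0) ⟩
    (C₀ ⋆ C k 0) r + (C₀ ⋆ C (suc k) 0) r + (C₀ ⋆ C↓ k) r + C₀ (suc r) * C k 0 0
      ≡⟨ cong (_+ C₀ (suc r) * C k 0 0) (sym (trans (⋆-distribˡ-+ C₀ (λ i → C k 0 i + C (suc k) 0 i) (C↓ k) r)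
                                                   (cong (_+ (C₀ ⋆ C↓ k) r) (⋆-distribˡ-+ C₀ (C k 0) (C (suc k) 0) r)))) ⟩
    (C₀ ⋆ (λ i → C k 0 i + C (suc k) 0 i + C↓ k i)) r + C₀ (suc r) * C k 0 0
      ≡⟨ cong (_+ C₀ (suc r) * C k 0 0) (⋆-cong (λ _ → refl) (λ i → sym (C-suc-size k i)) r) ⟩
    (C₀ ⋆ C k 0) (suc r) ∎
  where
    C₀ : ℕ → ℤ
    C₀ = C 0 0
    regroup : ∀ a b c d → a + b + (c + d) ≡ a + b + c + d
    regroup = solve-∀
    correction : ∀ k → C k 0 (suc r) ≡ (C₀ ⋆ C↓ k) r + C₀ (suc r) * C k 0 0
    correction zero = sym (trans (cong₂ _+_ (⋆-zeroʳ C₀ r) (ℤₚ.*-identityʳ (C₀ (suc r)))) (ℤₚ.+-identityˡ _))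
    correction (suc k) = trans (C-hooked₀ r k) (sym (trans (cong (λ z → (C₀ ⋆ C k 0) r + z) (ℤₚ.*-zeroʳ (C₀ (suc r)))) (ℤₚ.+-identityʳ _)))

-- The induction step reduces to C 1 t ⋆ C k 0 = C 0 t ⋆ C (suc k) 0, both sides being x C₀ₜ C₀₀ Cₖ₀.
C-hooked : ∀ t k r → C (suc k) t (suc r) ≡ (C 0 t ⋆ C k 0) r
C-hooked zero k r = C-hooked₀ r k
C-hooked (suc t) k r = begin
    C (suc k) (suc t) (suc r)                        ≡⟨ C-suc-tail (suc k) t (suc r) ⟩
    C (suc k) t (suc r) + C (suc (suc k)) t (suc r)  ≡⟨ cong₂ _+_ (C-hooked t k r) (C-hooked t (suc k) r) ⟩
    (Q ⋆ R) r + (Q ⋆ C (suc k) 0) r                  ≡⟨ cong (λ z → (Q ⋆ R) r + z) (sym reassociate) ⟩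
    (Q ⋆ R) r + (C 1 t ⋆ R) r                        ≡⟨ sym (⋆-distribʳ-+ Q (C 1 t) R r) ⟩
    ((λ i → Q i + C 1 t i) ⋆ R) r                    ≡⟨ ⋆-cong (λ i → sym (C-suc-tail 0 t i)) (λ _ → refl) r ⟩
    (C 0 (suc t) ⋆ R) r                              ∎
  where
    Q R : ℕ → ℤ
    Q = C 0 t
    R = C k 0
    C₁≡ : ∀ i → C 1 t i ≡ shift (Q ⋆ C 0 0) i
    C₁≡ zero = C-size-one 0 t
    C₁≡ (suc i) = C-hooked t 0 i
    Cₖ≡ : ∀ i → C (suc k) 0 i ≡ shift (C 0 0 ⋆ R) i
    Cₖ≡ zero = C-size-one k 0
    Cₖ≡ (suc i) = C-hooked₀ i k
    shifted : ∀ r → (R ⋆ shift (Q ⋆ C 0 0)) r ≡ (Q ⋆ shift (C 0 0 ⋆ R)) r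
    shifted zero = trans (⋆-shiftʳ-zero R (Q ⋆ C 0 0)) (sym (⋆-shiftʳ-zero Q (C 0 0 ⋆ R)))
    shifted (suc r) = begin
      (R ⋆ shift (Q ⋆ C 0 0)) (suc r)  ≡⟨ ⋆-shiftʳ R _ r ⟩
      (R ⋆ (Q ⋆ C 0 0)) r              ≡⟨ ⋆-comm R _ r ⟩
      ((Q ⋆ C 0 0) ⋆ R) r              ≡⟨ ⋆-assoc Q (C 0 0) R r ⟩
      (Q ⋆ (C 0 0 ⋆ R)) r              ≡⟨ sym (⋆-shiftʳ Q _ r) ⟩
      (Q ⋆ shift (C 0 0 ⋆ R)) (suc r)  ∎
    reassociate : (C 1 t ⋆ R) r ≡ (Q ⋆ C (suc k) 0) r
    reassociate = begin
      (C 1 t ⋆ R) r                    ≡⟨ ⋆-cong C₁≡ (λ _ → refl) r ⟩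
      (shift (Q ⋆ C 0 0) ⋆ R) r        ≡⟨ ⋆-comm _ R r ⟩
      (R ⋆ shift (Q ⋆ C 0 0)) r        ≡⟨ shifted r ⟩
      (Q ⋆ shift (C 0 0 ⋆ R)) r        ≡⟨ ⋆-cong (λ _ → refl) (λ i → sym (Cₖ≡ i)) r ⟩
      (Q ⋆ C (suc k) 0) r              ∎

T : ℕ → ℤ
T = shift (C 0 0)

J : ℕ → ℕ → ℤ
J ℓ n = + count (n ℕ.+ ℓ) 0 ℓ

count-top : ∀ m k → count m (suc k) m ≡ 0
count-top zero k = refl
count-top (suc zero) k = refl
count-top (suc (suc m)) k = cong₂ ℕ._+_ (count-top (suc m) k) (cong₂ ℕ._+_ (count-top (suc m) (suc k)) refl)

J-zero : ∀ ℓ → J ℓ 0 ≡ + 1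
J-zero ℓ = cong +_ (identity ℓ)
  where
    identity : ∀ m → count m 0 m ≡ 1
    identity zero = refl
    identity (suc zero) = refl
    identity (suc (suc m)) = cong₂ ℕ._+_ (identity (suc m)) (cong₂ ℕ._+_ (count-top (suc m) 0) refl)

J-suc : ∀ ℓ r → J ℓ (suc r) ≡ C 0 ℓ r
J-suc ℓ r = cong (λ m → + count (suc m) 0 ℓ) (+-comm r ℓ)

J-step : ∀ ℓ n → J (suc ℓ) n ≡ J ℓ n + (J ℓ ⋆ T) n - T n
J-step ℓ zero = trans (trans (J-zero (suc ℓ)) (sym (J-zero ℓ))) (pad (J ℓ 0))
  where
    pad : ∀ x → x ≡ x + x * + 0 - + 0
    pad = solve-∀
J-step ℓ (suc r) = begin
    J (suc ℓ) (suc r)                         ≡⟨ J-suc (suc ℓ) r ⟩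
    C 0 (suc ℓ) r                             ≡⟨ C-suc-tail 0 ℓ r ⟩
    C 0 ℓ r + C 1 ℓ r                         ≡⟨ cong₂ _+_ (sym (J-suc ℓ r)) (sym hooked) ⟩
    J ℓ (suc r) + ((J ℓ ⋆ T) (suc r) - T (suc r)) ≡⟨ sym (ℤₚ.+-assoc (J ℓ (suc r)) ((J ℓ ⋆ T) (suc r)) (- T (suc r))) ⟩
    J ℓ (suc r) + (J ℓ ⋆ T) (suc r) - T (suc r) ∎
  where
    C₀ : ℕ → ℤ
    C₀ = C 0 0
    J≡ : ∀ i → J ℓ i ≡ δ₀ i + shift (C 0 ℓ) i
    J≡ zero = J-zero ℓ
    J≡ (suc i) = J-suc ℓ i
    hooked-shifted : ∀ r → (shift (C 0 ℓ) ⋆ C₀) r ≡ C 1 ℓ r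
    hooked-shifted zero = sym (C-size-one 0 ℓ)
    hooked-shifted (suc r) = trans (⋆-shiftˡ (C 0 ℓ) C₀ r) (sym (C-hooked ℓ 0 r))
    hooked : (J ℓ ⋆ T) (suc r) - T (suc r) ≡ C 1 ℓ r
    hooked = begin
      (J ℓ ⋆ T) (suc r) - T (suc r)                       ≡⟨ cong (_- C₀ r) (trans (⋆-comm (J ℓ) T (suc r)) (⋆-shiftˡ C₀ (J ℓ) r)) ⟩
      (C₀ ⋆ J ℓ) r - C₀ r                                 ≡⟨ cong (_- C₀ r) (trans (⋆-comm C₀ (J ℓ) r) (⋆-cong J≡ (λ _ → refl) r)) ⟩
      ((λ i → δ₀ i + shift (C 0 ℓ) i) ⋆ C₀) r - C₀ r      ≡⟨ cong (_- C₀ r) (⋆-distribʳ-+ δ₀ (shift (C 0 ℓ)) C₀ r) ⟩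
      (δ₀ ⋆ C₀) r + (shift (C 0 ℓ) ⋆ C₀) r - C₀ r         ≡⟨ cong₂ (λ u v → u + v - C₀ r) (⋆-δ₀ˡ C₀ r) (hooked-shifted r) ⟩
      C₀ r + C 1 ℓ r - C₀ r                               ≡⟨ cancel (C₀ r) (C 1 ℓ r) ⟩
      C 1 ℓ r                                             ∎
      where
        cancel : ∀ x y → x + y - x ≡ y
        cancel = solve-∀

-- T / x is the Motzkin series.
T-motzkin : ∀ n → T (suc n) ≡ δ₀ n + T n + (T ⋆ T) n
T-motzkin zero = refl
T-motzkin (suc n) = begin
    C 0 0 (suc n)                        ≡⟨ C-suc-size 0 n ⟩
    C 0 0 n + C 1 0 n + + 0              ≡⟨ cong (λ z → C 0 0 n + z + + 0) (squared n) ⟩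
    T (suc n) + (T ⋆ T) (suc n) + + 0    ≡⟨ reorder (T (suc n)) ((T ⋆ T) (suc n)) ⟩
    δ₀ (suc n) + T (suc n) + (T ⋆ T) (suc n) ∎
  where
    squared : ∀ n → C 1 0 n ≡ (T ⋆ T) (suc n)
    squared zero = refl
    squared (suc m) = trans (C-hooked₀ m 0)
      (sym (trans (⋆-shiftʳ T (C 0 0) (suc m)) (trans (⋆-comm T (C 0 0) (suc m)) (⋆-shiftʳ (C 0 0) (C 0 0) m))))
    reorder : ∀ x y → x + y + + 0 ≡ + 0 + x + y
    reorder = solve-∀

E : ℕ → ℤ
E n = δ₁ n + + 2 * shift T n

√disc : ℕ → ℤ
√disc n = δ₀ n - E n

⋆-self-unfold : ∀ f m → f 0 ≡ + 1 → (f ⋆ f) (suc (suc m)) ≡ f (suc (suc m)) + ((λ i → f (suc i)) ⋆ (λ i → f (suc i))) m + f (suc (suc m))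
⋆-self-unfold f m f₀≡1 = begin
    (f ⋆ f) (suc (suc m))
      ≡⟨ ⋆-unfoldˡ f f (suc m) ⟩
    f 0 * f (suc (suc m)) + ((f′ ⋆ f′) m + f (suc (suc m)) * f 0)
      ≡⟨ cong₂ (λ u v → u * f (suc (suc m)) + ((f′ ⋆ f′) m + f (suc (suc m)) * v)) f₀≡1 f₀≡1 ⟩
    + 1 * f (suc (suc m)) + ((f′ ⋆ f′) m + f (suc (suc m)) * + 1)
      ≡⟨ unit (f (suc (suc m))) ((f′ ⋆ f′) m) ⟩
    f (suc (suc m)) + (f′ ⋆ f′) m + f (suc (suc m)) ∎
  where
    f′ : ℕ → ℤ
    f′ i = f (suc i)
    unit : ∀ x c → + 1 * x + (c + x * + 1) ≡ x + c + x
    unit = solve-∀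

-- The coefficient of xⁿ⁺¹ in S² is 2 Sₙ₊₁ plus terms involving only S₁, …, Sₙ.
sqrt-unique : ∀ S S′ → S 0 ≡ + 1 → S′ 0 ≡ + 1 → (∀ n → (S ⋆ S) n ≡ (S′ ⋆ S′) n) → ∀ n → S n ≡ S′ n
sqrt-unique S S′ S₀ S′₀ sq≡ = λ n → below n n ≤-refl
  where
    half : ∀ x y c → x + c + x ≡ y + c + y → x ≡ y
    half x y c eq = ℤₚ.*-cancelˡ-≡ (+ 2) x y (trans (twice x c) (trans (cong (_- c) eq) (sym (twice y c))))
      where
        twice : ∀ z c → + 2 * z ≡ z + c + z - c
        twice = solve-∀
    step : ∀ n → (∀ i → i ≤ n → S i ≡ S′ i) → S (suc n) ≡ S′ (suc n)
    step zero _ = half (S 1) (S′ 1) (+ 0) (begin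
      S 1 + + 0 + S 1        ≡⟨ unfold S S₀ ⟩
      (S ⋆ S) 1              ≡⟨ sq≡ 1 ⟩
      (S′ ⋆ S′) 1            ≡⟨ sym (unfold S′ S′₀) ⟩
      S′ 1 + + 0 + S′ 1      ∎)
      where
        unfold : ∀ f → f 0 ≡ + 1 → f 1 + + 0 + f 1 ≡ (f ⋆ f) 1
        unfold f f₀ rewrite f₀ = unit (f 1)
          where
            unit : ∀ x → x + + 0 + x ≡ + 1 * x + x * + 1
            unit = solve-∀
    step (suc m) ih = half (S (suc (suc m))) (S′ (suc (suc m))) ((S⁺ ⋆ S⁺) m) (begin
      S (suc (suc m)) + (S⁺ ⋆ S⁺) m + S (suc (suc m))     ≡⟨ sym (⋆-self-unfold S m S₀) ⟩
      (S ⋆ S) (suc (suc m))                               ≡⟨ sq≡ (suc (suc m)) ⟩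
      (S′ ⋆ S′) (suc (suc m))                             ≡⟨ ⋆-self-unfold S′ m S′₀ ⟩
      S′ (suc (suc m)) + (S′⁺ ⋆ S′⁺) m + S′ (suc (suc m))  ≡⟨ cong (λ z → S′ (suc (suc m)) + z + S′ (suc (suc m))) (sym lower) ⟩
      S′ (suc (suc m)) + (S⁺ ⋆ S⁺) m + S′ (suc (suc m))   ∎)
      where
        S⁺ S′⁺ : ℕ → ℤ
        S⁺ i = S (suc i)
        S′⁺ i = S′ (suc i)
        lower : (S⁺ ⋆ S⁺) m ≡ (S′⁺ ⋆ S′⁺) m
        lower = ⋆-cong-≤ m (λ i i≤ → ih (suc i) (s≤s i≤)) (λ i i≤ → ih (suc i) (s≤s i≤))
    below : ∀ n i → i ≤ n → S i ≡ S′ i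
    below zero zero _ = trans S₀ (sym S′₀)
    below (suc n) i i≤ with m≤n⇒m<n∨m≡n i≤
    ... | inj₁ (s≤s i≤n) = below n i i≤n
    ... | inj₂ refl = step n (below n)

-- With U = 1 + 2T we have E = x U, so E² = x² U² and the Motzkin equation for T collapses (√disc)² to disc.
√disc-squared : ∀ n → (√disc ⋆ √disc) n ≡ disc n
√disc-squared zero = refl
√disc-squared (suc zero) = refl
√disc-squared (suc (suc m)) = begin
    (√disc ⋆ √disc) (suc (suc m))
      ≡⟨ expand (suc (suc m)) ⟩
    + 0 - E (suc (suc m)) - E (suc (suc m)) + (E ⋆ E) (suc (suc m))
      ≡⟨ cong (λ z → + 0 - E (suc (suc m)) - E (suc (suc m)) + z) (trans E²≡U² U²) ⟩
    + 0 - E (suc (suc m)) - E (suc (suc m)) + (δ₀ m + + 4 * T m + + 4 * (T ⋆ T) m)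
      ≡⟨ cong (λ z → + 0 - (+ 0 + + 2 * z) - (+ 0 + + 2 * z) + (δ₀ m + + 4 * T m + + 4 * (T ⋆ T) m)) (T-motzkin m) ⟩
    + 0 - (+ 0 + + 2 * (δ₀ m + T m + (T ⋆ T) m)) - (+ 0 + + 2 * (δ₀ m + T m + (T ⋆ T) m)) + (δ₀ m + + 4 * T m + + 4 * (T ⋆ T) m)
      ≡⟨ collapse (δ₀ m) (T m) ((T ⋆ T) m) ⟩
    - (+ 3 * δ₀ m)
      ≡⟨ disc-tail m ⟩
    disc (suc (suc m)) ∎
  where
    U : ℕ → ℤ
    U n = δ₀ n + + 2 * T n
    E≡xU : ∀ n → E n ≡ shift U n
    E≡xU zero = refl
    E≡xU (suc zero) = refl
    E≡xU (suc (suc n)) = refl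
    expand : ∀ n → (√disc ⋆ √disc) n ≡ δ₀ n - E n - E n + (E ⋆ E) n
    expand n = begin
        (√disc ⋆ √disc) n
          ≡⟨ ⋆-distribʳ-+ δ₀ (λ i → - E i) √disc n ⟩
        (δ₀ ⋆ √disc) n + ((λ i → - E i) ⋆ √disc) n
          ≡⟨ cong₂ _+_ (⋆-δ₀ˡ √disc n) (⋆-distribˡ-+ (λ i → - E i) δ₀ (λ i → - E i) n) ⟩
        √disc n + (((λ i → - E i) ⋆ δ₀) n + ((λ i → - E i) ⋆ (λ i → - E i)) n)
          ≡⟨ cong (λ z → √disc n + z) (cong₂ _+_ (⋆-δ₀ʳ (λ i → - E i) n)
               (trans (⋆-negˡ E (λ i → - E i) n) (trans (cong -_ (⋆-negʳ E E n)) (ℤₚ.neg-involutive _)))) ⟩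
        √disc n + (- E n + (E ⋆ E) n)
          ≡⟨ regroup (δ₀ n) (E n) ((E ⋆ E) n) ⟩
        δ₀ n - E n - E n + (E ⋆ E) n ∎
      where
        regroup : ∀ d e c → d - e + (- e + c) ≡ d - e - e + c
        regroup = solve-∀
    E²≡U² : (E ⋆ E) (suc (suc m)) ≡ (U ⋆ U) m
    E²≡U² = begin
      (E ⋆ E) (suc (suc m))             ≡⟨ ⋆-cong E≡xU E≡xU (suc (suc m)) ⟩
      (shift U ⋆ shift U) (suc (suc m)) ≡⟨ ⋆-shiftʳ (shift U) U (suc m) ⟩
      (shift U ⋆ U) (suc m)             ≡⟨ ⋆-shiftˡ U U m ⟩
      (U ⋆ U) m                         ∎
    U² : (U ⋆ U) m ≡ δ₀ m + + 4 * T m + + 4 * (T ⋆ T) m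
    U² = begin
        (U ⋆ U) m
          ≡⟨ ⋆-distribʳ-+ δ₀ (λ i → + 2 * T i) U m ⟩
        (δ₀ ⋆ U) m + ((λ i → + 2 * T i) ⋆ U) m
          ≡⟨ cong₂ _+_ (⋆-δ₀ˡ U m) (trans (⋆-*ˡ (+ 2) T U m) (cong (+ 2 *_) (⋆-distribˡ-+ T δ₀ (λ i → + 2 * T i) m))) ⟩
        U m + + 2 * ((T ⋆ δ₀) m + (T ⋆ (λ i → + 2 * T i)) m)
          ≡⟨ cong (λ z → U m + + 2 * z) (cong₂ _+_ (⋆-δ₀ʳ T m) (⋆-*ʳ T T (+ 2) m)) ⟩
        U m + + 2 * (T m + + 2 * (T ⋆ T) m)
          ≡⟨ expand-U (δ₀ m) (T m) ((T ⋆ T) m) ⟩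
        δ₀ m + + 4 * T m + + 4 * (T ⋆ T) m ∎
      where
        expand-U : ∀ d t c → d + + 2 * t + + 2 * (t + + 2 * c) ≡ d + + 4 * t + + 4 * c
        expand-U = solve-∀
    collapse : ∀ d t c → + 0 - (+ 0 + + 2 * (d + t + c)) - (+ 0 + + 2 * (d + t + c)) + (d + + 4 * t + + 4 * c) ≡ - (+ 3 * d)
    collapse = solve-∀
    disc-tail : ∀ m → - (+ 3 * δ₀ m) ≡ disc (suc (suc m))
    disc-tail zero = refl
    disc-tail (suc m) = refl

IsSqrtDisc⇒≡√disc : ∀ S → IsSqrtDisc S → ∀ n → S n ≡ √disc n
IsSqrtDisc⇒≡√disc S (S₀ , S²) = sqrt-unique S √disc S₀ refl (λ n → trans (sym (sumTo-⋆ S S n)) (trans (S² n) (sym (√disc-squared n))))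

-- Series in x and z

sumTo-+ : ∀ n (f g : ℕ → ℤ) → sumTo n (λ i → f i + g i) ≡ sumTo n f + sumTo n g
sumTo-+ zero f g = refl
sumTo-+ (suc n) f g rewrite sumTo-+ n f g = interchange (sumTo n f) (sumTo n g) (f (suc n)) (g (suc n))
  where
    interchange : ∀ a b c d → a + b + (c + d) ≡ a + c + (b + d)
    interchange = solve-∀

sumTo-neg : ∀ n (f : ℕ → ℤ) → sumTo n (λ i → - f i) ≡ - sumTo n f
sumTo-neg zero f = refl
sumTo-neg (suc n) f rewrite sumTo-neg n f = sym (ℤₚ.neg-distrib-+ (sumTo n f) (f (suc n)))

sumTo-zero : ∀ n (f : ℕ → ℤ) → (∀ i → i ≤ n → f i ≡ + 0) → sumTo n f ≡ + 0
sumTo-zero zero f f≡0 = f≡0 0 z≤n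
sumTo-zero (suc n) f f≡0 = cong₂ _+_ (sumTo-zero n f (λ i i≤ → f≡0 i (m≤n⇒m≤1+n i≤))) (f≡0 (suc n) ≤-refl)

sumTo-single : ∀ n k (f : ℕ → ℤ) → (∀ i → i ≤ n → i ≢ k → f i ≡ + 0) → k ≤ n → sumTo n f ≡ f k
sumTo-single zero zero f _ _ = refl
sumTo-single (suc n) k f f≡0 k≤ with m≤n⇒m<n∨m≡n k≤
... | inj₁ (s≤s k≤n) = trans (cong₂ _+_ (sumTo-single n k f (λ i i≤ → f≡0 i (m≤n⇒m≤1+n i≤)) k≤n)
                                        (f≡0 (suc n) ≤-refl (λ e → <-irrefl (sym e) (s≤s k≤n))))
                             (ℤₚ.+-identityʳ (f k))
... | inj₂ refl = trans (cong (_+ f (suc n)) (sumTo-zero n f (λ i i≤ → f≡0 i (m≤n⇒m≤1+n i≤) (λ e → <-irrefl e (s≤s i≤)))))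
                        (ℤₚ.+-identityˡ _)

sumTo-last-three : ∀ l (f : ℕ → ℤ) → (∀ j → j < l → f j ≡ + 0) → sumTo (suc (suc l)) f ≡ f l + f (suc l) + f (suc (suc l))
sumTo-last-three zero f _ = refl
sumTo-last-three (suc l) f f≡0 =
  cong (λ z → z + f (suc (suc l)) + f (suc (suc (suc l))))
       (sumTo-single (suc l) (suc l) f (λ j j≤ j≢ → f≡0 j (≤∧≢⇒< j≤ j≢)) ≤-refl)

sumTo-swap : ∀ n l (h : ℕ → ℕ → ℤ) → sumTo n (λ i → sumTo l (h i)) ≡ sumTo l (λ j → sumTo n (λ i → h i j))
sumTo-swap zero l h = refl
sumTo-swap (suc n) l h = trans (cong (_+ sumTo l (h (suc n))) (sumTo-swap n l h))
                               (sym (sumTo-+ l (λ j → sumTo n (λ i → h i j)) (h (suc n))))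

column : Ser → ℕ → ℕ → ℤ
column F ℓ n = F n ℓ

⊛-columns : ∀ F G n ℓ → (F ⊛ G) n ℓ ≡ sumTo ℓ (λ j → (column F j ⋆ column G (ℓ ∸ j)) n)
⊛-columns F G n ℓ = trans (sumTo-swap n ℓ (λ i j → F i j * G (n ∸ i) (ℓ ∸ j)))
                          (sumTo-cong-≤ ℓ (λ j _ → sumTo-⋆ (column F j) (column G (ℓ ∸ j)) n))

⊛-⊕ˡ : ∀ F F′ G n ℓ → ((F ⊕ F′) ⊛ G) n ℓ ≡ (F ⊛ G) n ℓ + (F′ ⊛ G) n ℓ
⊛-⊕ˡ F F′ G n ℓ = trans (sumTo-cong-≤ n (λ i _ → trans (sumTo-cong-≤ ℓ (λ j _ → ℤₚ.*-distribʳ-+ _ (F i j) (F′ i j)))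
                                                          (sumTo-+ ℓ _ _)))
                        (sumTo-+ n _ _)

⊛-⊖ˡ : ∀ F G n ℓ → ((⊖ F) ⊛ G) n ℓ ≡ - (F ⊛ G) n ℓ
⊛-⊖ˡ F G n ℓ = trans (sumTo-cong-≤ n (λ i _ → trans (sumTo-cong-≤ ℓ (λ j _ → sym (ℤₚ.neg-distribˡ-* (F i j) _)))
                                                       (sumTo-neg ℓ _)))
                     (sumTo-neg n _)

SupportedAt : Ser → ℕ → ℕ → Set
SupportedAt F a b = ∀ i j → i ≢ a ⊎ j ≢ b → F i j ≡ + 0

⊛-monomialˡ : ∀ F G a b n ℓ → SupportedAt F a b → a ≤ n → b ≤ ℓ → (F ⊛ G) n ℓ ≡ F a b * G (n ∸ a) (ℓ ∸ b)
⊛-monomialˡ F G a b n ℓ F≡0 a≤n b≤ℓ =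
  trans (sumTo-single n a _ (λ i _ i≢a → sumTo-zero ℓ _ (λ j _ → cong (_* G (n ∸ i) (ℓ ∸ j)) (F≡0 i j (inj₁ i≢a)))) a≤n)
        (sumTo-single ℓ b _ (λ j _ j≢b → cong (_* G (n ∸ a) (ℓ ∸ j)) (F≡0 a j (inj₂ j≢b))) b≤ℓ)

⊛-monomialˡ-outside : ∀ F G a b n ℓ → SupportedAt F a b → ¬ (a ≤ n) ⊎ ¬ (b ≤ ℓ) → (F ⊛ G) n ℓ ≡ + 0
⊛-monomialˡ-outside F G a b n ℓ F≡0 outside =
  sumTo-zero n _ (λ i i≤ → sumTo-zero ℓ _ (λ j j≤ → cong (_* G (n ∸ i) (ℓ ∸ j)) (F≡0 i j (off i j i≤ j≤))))
  where
    off : ∀ i j → i ≤ n → j ≤ ℓ → i ≢ a ⊎ j ≢ b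
    off i j i≤ j≤ = Sum.map (λ a≰n i≡a → a≰n (subst (_≤ n) i≡a i≤)) (λ b≰ℓ j≡b → b≰ℓ (subst (_≤ ℓ) j≡b j≤)) outside

⊛-monomialʳ : ∀ F G a b n ℓ → SupportedAt G a b → a ≤ n → b ≤ ℓ → (F ⊛ G) n ℓ ≡ F (n ∸ a) (ℓ ∸ b) * G a b
⊛-monomialʳ F G a b n ℓ G≡0 a≤n b≤ℓ =
  trans (sumTo-single n (n ∸ a) _ (λ i i≤ i≢ → sumTo-zero ℓ _ (λ j _ →
           trans (cong (F i j *_) (G≡0 (n ∸ i) (ℓ ∸ j) (inj₁ (λ e → i≢ (complement i≤ e))))) (ℤₚ.*-zeroʳ (F i j))))
           (m∸n≤m n a))
    (trans (sumTo-single ℓ (ℓ ∸ b) _ (λ j j≤ j≢ →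
              trans (cong (F (n ∸ a) j *_) (G≡0 _ _ (inj₂ (λ e → j≢ (complement j≤ e))))) (ℤₚ.*-zeroʳ (F (n ∸ a) j)))
              (m∸n≤m ℓ b))
           (cong₂ (λ u v → F (n ∸ a) (ℓ ∸ b) * G u v) (m∸[m∸n]≡n a≤n) (m∸[m∸n]≡n b≤ℓ)))
  where
    complement : ∀ {m i k} → i ≤ m → m ∸ i ≡ k → i ≡ m ∸ k
    complement i≤ e = trans (sym (m∸[m∸n]≡n i≤)) (cong (_ ∸_) e)

⊛-monomialʳ-outside : ∀ F G a b n ℓ → SupportedAt G a b → ¬ (a ≤ n) ⊎ ¬ (b ≤ ℓ) → (F ⊛ G) n ℓ ≡ + 0
⊛-monomialʳ-outside F G a b n ℓ G≡0 outside =
  sumTo-zero n _ (λ i i≤ → sumTo-zero ℓ _ (λ j j≤ → trans (cong (F i j *_) (G≡0 _ _ (off i j))) (ℤₚ.*-zeroʳ (F i j))))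
  where
    off : ∀ i j → n ∸ i ≢ a ⊎ ℓ ∸ j ≢ b
    off i j = Sum.map (λ a≰n e → a≰n (subst (_≤ n) e (m∸n≤m n i))) (λ b≰ℓ e → b≰ℓ (subst (_≤ ℓ) e (m∸n≤m ℓ j))) outside

cst-supported : ∀ c → SupportedAt (cst c) 0 0
cst-supported c zero zero (inj₁ 0≢0) = ⊥-elim (0≢0 refl)
cst-supported c zero zero (inj₂ 0≢0) = ⊥-elim (0≢0 refl)
cst-supported c zero (suc j) _ = refl
cst-supported c (suc i) j _ = refl

X-supported : SupportedAt X 1 0
X-supported (suc zero) zero (inj₁ 1≢1) = ⊥-elim (1≢1 refl)
X-supported (suc zero) zero (inj₂ 0≢0) = ⊥-elim (0≢0 refl)
X-supported zero j _ = refl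
X-supported (suc zero) (suc j) _ = refl
X-supported (suc (suc i)) j _ = refl

Z-supported : SupportedAt Z 0 1
Z-supported zero (suc zero) (inj₁ 0≢0) = ⊥-elim (0≢0 refl)
Z-supported zero (suc zero) (inj₂ 1≢1) = ⊥-elim (1≢1 refl)
Z-supported zero zero _ = refl
Z-supported zero (suc (suc j)) _ = refl
Z-supported (suc i) j _ = refl

shiftX shiftZ : Ser → Ser
shiftX G zero ℓ = + 0
shiftX G (suc n) ℓ = G n ℓ
shiftZ G n zero = + 0
shiftZ G n (suc ℓ) = G n ℓ

cst-⊛ : ∀ c G n ℓ → (cst c ⊛ G) n ℓ ≡ c * G n ℓ
cst-⊛ c G n ℓ = ⊛-monomialˡ (cst c) G 0 0 n ℓ (cst-supported c) z≤n z≤n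

X-⊛ : ∀ G n ℓ → (X ⊛ G) n ℓ ≡ shiftX G n ℓ
X-⊛ G zero ℓ = ⊛-monomialˡ-outside X G 1 0 0 ℓ X-supported (inj₁ (λ ()))
X-⊛ G (suc n) ℓ = trans (⊛-monomialˡ X G 1 0 (suc n) ℓ X-supported (s≤s z≤n) z≤n) (ℤₚ.*-identityˡ _)

Z-⊛ : ∀ G n ℓ → (Z ⊛ G) n ℓ ≡ shiftZ G n ℓ
Z-⊛ G n zero = ⊛-monomialˡ-outside Z G 0 1 n 0 Z-supported (inj₂ (λ ()))
Z-⊛ G n (suc ℓ) = trans (⊛-monomialˡ Z G 0 1 n (suc ℓ) Z-supported z≤n (s≤s z≤n)) (ℤₚ.*-identityˡ _)

⊛-Z : ∀ G n ℓ → (G ⊛ Z) n ℓ ≡ shiftZ G n ℓ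
⊛-Z G n zero = ⊛-monomialʳ-outside G Z 0 1 n 0 Z-supported (inj₂ (λ ()))
⊛-Z G n (suc ℓ) = trans (⊛-monomialʳ G Z 0 1 n (suc ℓ) Z-supported z≤n (s≤s z≤n)) (ℤₚ.*-identityʳ _)

module Coefficients (S : ℕ → ℤ) where

  1-S : Ser
  1-S = cst (+ 1) ⊝ embX S

  e : ℕ → ℤ
  e n = 1-S n 0

  1-S-z⁺ : ∀ n ℓ → 1-S n (suc ℓ) ≡ + 0
  1-S-z⁺ zero ℓ = refl
  1-S-z⁺ (suc n) ℓ = refl

  private
    H G : Ser
    H = cst (- + 2) ⊕ Z
    G = (X ⊛ H) ⊕ (1-S ⊛ Z)

    G≡ : ∀ n ℓ → G n ℓ ≡ shiftX H n ℓ + shiftZ 1-S n ℓ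
    G≡ n ℓ = cong₂ _+_ (X-⊛ H n ℓ) (⊛-Z 1-S n ℓ)

    Den≡ : ∀ n ℓ → Den S n ℓ ≡ G n ℓ - shiftZ G n ℓ
    Den≡ n ℓ = trans (⊛-⊕ˡ (cst (+ 1)) (⊖ Z) G n ℓ)
                     (cong₂ _+_ (trans (cst-⊛ (+ 1) G n ℓ) (ℤₚ.*-identityˡ _)) (trans (⊛-⊖ˡ Z G n ℓ) (cong -_ (Z-⊛ G n ℓ))))

    H-z≥2 : ∀ n ℓ → shiftX H n (suc (suc ℓ)) ≡ + 0
    H-z≥2 zero ℓ = refl
    H-z≥2 (suc n) ℓ = cong₂ _+_ (cst-supported _ n _ (inj₂ (λ ()))) (Z-supported n _ (inj₂ (λ ())))

    H-z¹ : ∀ n → shiftX H n 1 ≡ δ₁ n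
    H-z¹ zero = refl
    H-z¹ (suc zero) = refl
    H-z¹ (suc (suc n)) = refl

  Den-z⁰ : ∀ n → Den S n 0 ≡ - (+ 2 * δ₁ n)
  Den-z⁰ n = trans (Den≡ n 0) (trans (cong (_- + 0) (G≡ n 0)) (value n))
    where
      value : ∀ n → shiftX H n 0 + shiftZ 1-S n 0 - + 0 ≡ - (+ 2 * δ₁ n)
      value zero = refl
      value (suc zero) = refl
      value (suc (suc n)) = refl

  Den-z¹ : ∀ n → Den S n 1 ≡ + 3 * δ₁ n + e n
  Den-z¹ n = trans (Den≡ n 1) (trans (cong₂ _-_ (G≡ n 1) (G≡ n 0)) (trans (regroup (shiftX H n 1) (shiftX H n 0) (e n)) (value n)))
    where
      regroup : ∀ h h₀ f → h + f - (h₀ + + 0) ≡ (h - h₀) + f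
      regroup = solve-∀
      value : ∀ n → shiftX H n 1 - shiftX H n 0 + e n ≡ + 3 * δ₁ n + e n
      value zero = refl
      value (suc zero) = refl
      value (suc (suc n)) = refl

  Den-z² : ∀ n → Den S n 2 ≡ - (δ₁ n + e n)
  Den-z² n = begin
      Den S n 2
        ≡⟨ Den≡ n 2 ⟩
      G n 2 - G n 1
        ≡⟨ cong₂ _-_ (G≡ n 2) (G≡ n 1) ⟩
      shiftX H n 2 + 1-S n 1 - (shiftX H n 1 + e n)
        ≡⟨ cong₂ (λ u v → u + v - (shiftX H n 1 + e n)) (H-z≥2 n 0) (1-S-z⁺ n 0) ⟩
      + 0 + + 0 - (shiftX H n 1 + e n)
        ≡⟨ cong (λ z → + 0 + + 0 - (z + e n)) (H-z¹ n) ⟩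
      + 0 + + 0 - (δ₁ n + e n)
        ≡⟨ ℤₚ.+-identityˡ _ ⟩
      - (δ₁ n + e n) ∎

  Den-z³⁺ : ∀ n ℓ → Den S n (suc (suc (suc ℓ))) ≡ + 0
  Den-z³⁺ n ℓ = trans (Den≡ n (suc (suc (suc ℓ)))) (trans (cong₂ _-_ (G≡ n (suc (suc (suc ℓ)))) (G≡ n (suc (suc ℓ))))
                  (cong₂ (λ u v → u - v) (cong₂ _+_ (H-z≥2 n (suc ℓ)) (1-S-z⁺ n (suc ℓ))) (cong₂ _+_ (H-z≥2 n ℓ) (1-S-z⁺ n ℓ))))

  private
    Num≡ : ∀ n ℓ → Num S n ℓ ≡ - 1-S n ℓ + + 2 * shiftZ 1-S n ℓ - X n ℓ
    Num≡ n ℓ = begin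
        ((cst (- + 1) ⊕ (cst (+ 2) ⊛ Z)) ⊛ 1-S) n ℓ + - X n ℓ
          ≡⟨ cong (_+ - X n ℓ) (⊛-⊕ˡ (cst (- + 1)) (cst (+ 2) ⊛ Z) 1-S n ℓ) ⟩
        (cst (- + 1) ⊛ 1-S) n ℓ + ((cst (+ 2) ⊛ Z) ⊛ 1-S) n ℓ + - X n ℓ
          ≡⟨ cong₂ (λ u v → u + v + - X n ℓ) (trans (cst-⊛ (- + 1) 1-S n ℓ) (ℤₚ.-1*i≡-i _)) (2z-⊛ ℓ) ⟩
        - 1-S n ℓ + + 2 * shiftZ 1-S n ℓ - X n ℓ ∎
      where
        2z≡ : ∀ i j → (cst (+ 2) ⊛ Z) i j ≡ + 2 * Z i j
        2z≡ i j = cst-⊛ (+ 2) Z i j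
        2z-supported : SupportedAt (cst (+ 2) ⊛ Z) 0 1
        2z-supported i j off = trans (2z≡ i j) (cong (+ 2 *_) (Z-supported i j off))
        2z-⊛ : ∀ ℓ → ((cst (+ 2) ⊛ Z) ⊛ 1-S) n ℓ ≡ + 2 * shiftZ 1-S n ℓ
        2z-⊛ zero = ⊛-monomialˡ-outside (cst (+ 2) ⊛ Z) 1-S 0 1 n 0 2z-supported (inj₂ (λ ()))
        2z-⊛ (suc ℓ) = trans (⊛-monomialˡ (cst (+ 2) ⊛ Z) 1-S 0 1 n (suc ℓ) 2z-supported z≤n (s≤s z≤n)) (cong (_* 1-S n ℓ) (2z≡ 0 1))

  Num-z⁰ : ∀ n → Num S n 0 ≡ - e n - δ₁ n
  Num-z⁰ n = trans (Num≡ n 0) (trans (drop-zero (- e n) (X n 0)) (cong (λ z → - e n - z) (X-z⁰ n)))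
    where
      drop-zero : ∀ a b → a + + 2 * + 0 - b ≡ a - b
      drop-zero = solve-∀
      X-z⁰ : ∀ n → X n 0 ≡ δ₁ n
      X-z⁰ zero = refl
      X-z⁰ (suc zero) = refl
      X-z⁰ (suc (suc n)) = refl

  Num-z¹ : ∀ n → Num S n 1 ≡ + 2 * e n
  Num-z¹ n = trans (Num≡ n 1) (trans (cong₂ (λ u v → - u + + 2 * e n - v) (1-S-z⁺ n 0) (X-z¹ n)) (drop-zero (e n)))
    where
      X-z¹ : ∀ n → X n 1 ≡ + 0
      X-z¹ zero = refl
      X-z¹ (suc zero) = refl
      X-z¹ (suc (suc n)) = refl
      drop-zero : ∀ z → - + 0 + + 2 * z - + 0 ≡ + 2 * z
      drop-zero = solve-∀

  Num-z²⁺ : ∀ n ℓ → Num S n (suc (suc ℓ)) ≡ + 0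
  Num-z²⁺ n ℓ = trans (Num≡ n (suc (suc ℓ)))
    (trans (cong₂ (λ u v → - u + + 2 * v - X n (suc (suc ℓ))) (1-S-z⁺ n (suc ℓ)) (1-S-z⁺ n ℓ)) (value n))
    where
      value : ∀ n → - + 0 + + 2 * + 0 - X n (suc (suc ℓ)) ≡ + 0
      value zero = refl
      value (suc zero) = refl
      value (suc (suc n)) = refl

2xJ₀ : ∀ n → + 2 * shift (J 0) n ≡ δ₁ n + E n
2xJ₀ zero = refl
2xJ₀ (suc zero) = refl
2xJ₀ (suc (suc m)) = trans (cong (+ 2 *_) (J-suc 0 m)) (sym (trans (ℤₚ.+-identityˡ _) (ℤₚ.+-identityˡ _)))

2xJ-step : ∀ ℓ n → + 2 * shift (J (suc ℓ)) n ≡ (J ℓ ⋆ E) n + shift (J ℓ) n + δ₁ n - E n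
2xJ-step ℓ zero = sym (cong (λ z → z + + 0 + + 0 - + 0) (ℤₚ.*-zeroʳ (J ℓ 0)))
2xJ-step ℓ (suc m) = begin
    + 2 * J (suc ℓ) m                                       ≡⟨ cong (+ 2 *_) (J-step ℓ m) ⟩
    + 2 * (J ℓ m + (J ℓ ⋆ T) m - T m)                       ≡⟨ expand (J ℓ m) ((J ℓ ⋆ T) m) (T m) (δ₁ (suc m)) ⟩
    (J ℓ m + + 2 * (J ℓ ⋆ T) m) + J ℓ m + δ₁ (suc m) - E (suc m) ≡⟨ cong (λ z → z + J ℓ m + δ₁ (suc m) - E (suc m)) (sym J⋆E) ⟩
    (J ℓ ⋆ E) (suc m) + J ℓ m + δ₁ (suc m) - E (suc m)      ∎
  where
    J⋆E : (J ℓ ⋆ E) (suc m) ≡ J ℓ m + + 2 * (J ℓ ⋆ T) m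
    J⋆E = begin
      (J ℓ ⋆ E) (suc m)                                     ≡⟨ ⋆-distribˡ-+ (J ℓ) δ₁ (λ i → + 2 * shift T i) (suc m) ⟩
      (J ℓ ⋆ δ₁) (suc m) + (J ℓ ⋆ (λ i → + 2 * shift T i)) (suc m)
        ≡⟨ cong₂ _+_ (⋆-δ₁ʳ (J ℓ) (suc m)) (trans (⋆-*ʳ (J ℓ) (shift T) (+ 2) (suc m)) (cong (+ 2 *_) (⋆-shiftʳ (J ℓ) T m))) ⟩
      J ℓ m + + 2 * (J ℓ ⋆ T) m                             ∎
    expand : ∀ x c u y → + 2 * (x + c - u) ≡ (x + + 2 * c) + x + y - (y + + 2 * u)
    expand = solve-∀

module _ (S : ℕ → ℤ) (S-sqrt : IsSqrtDisc S) where
  open Coefficients S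

  private
    e≡E : ∀ n → e n ≡ E n
    e≡E n = trans (cong₂ (λ d s → d + - s) (δ₀≡ n) (IsSqrtDisc⇒≡√disc S S-sqrt n)) (cancel (δ₀ n) (E n))
      where
        δ₀≡ : ∀ n → cst (+ 1) n 0 ≡ δ₀ n
        δ₀≡ zero = refl
        δ₀≡ (suc n) = refl
        cancel : ∀ d e → d + - (d - e) ≡ e
        cancel = solve-∀

    ⋆-Den-z⁰ : ∀ f n → (f ⋆ column (Den S) 0) n ≡ - (+ 2 * shift f n)
    ⋆-Den-z⁰ f n = trans (⋆-cong (λ _ → refl) Den-z⁰ n)
      (trans (⋆-negʳ f (λ x → + 2 * δ₁ x) n) (cong -_ (trans (⋆-*ʳ f δ₁ (+ 2) n) (cong (+ 2 *_) (⋆-δ₁ʳ f n)))))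

    ⋆-Den-z¹ : ∀ f n → (f ⋆ column (Den S) 1) n ≡ + 3 * shift f n + (f ⋆ E) n
    ⋆-Den-z¹ f n = trans (⋆-cong (λ _ → refl) (λ x → trans (Den-z¹ x) (cong (λ z → + 3 * δ₁ x + z) (e≡E x))) n)
      (trans (⋆-distribˡ-+ f (λ x → + 3 * δ₁ x) E n)
             (cong (_+ (f ⋆ E) n) (trans (⋆-*ʳ f δ₁ (+ 3) n) (cong (+ 3 *_) (⋆-δ₁ʳ f n)))))

    ⋆-Den-z² : ∀ f n → (f ⋆ column (Den S) 2) n ≡ - (shift f n + (f ⋆ E) n)
    ⋆-Den-z² f n = trans (⋆-cong (λ _ → refl) (λ x → trans (Den-z² x) (cong (λ z → - (δ₁ x + z)) (e≡E x))) n)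
      (trans (⋆-negʳ f (λ x → δ₁ x + E x) n) (cong -_ (trans (⋆-distribˡ-+ f δ₁ E n) (cong (_+ (f ⋆ E) n) (⋆-δ₁ʳ f n)))))

    ⋆-Den-z³⁺ : ∀ f n ℓ → (f ⋆ column (Den S) (suc (suc (suc ℓ)))) n ≡ + 0
    ⋆-Den-z³⁺ f n ℓ = trans (⋆-cong (λ _ → refl) (λ x → Den-z³⁺ x ℓ) n) (⋆-zeroʳ f n)

    ∸-≥3 : ∀ l j → j < l → suc (suc l) ∸ j ≡ suc (suc (suc (l ∸ suc j)))
    ∸-≥3 (suc l) zero _ = refl
    ∸-≥3 (suc l) (suc j) (s≤s j<l) = ∸-≥3 l j j<l

  J⊛Den≡Num : ∀ n ℓ → sumTo ℓ (λ j → (J j ⋆ column (Den S) (ℓ ∸ j)) n) ≡ Num S n ℓ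
  J⊛Den≡Num n zero = begin
      (J 0 ⋆ column (Den S) 0) n   ≡⟨ ⋆-Den-z⁰ (J 0) n ⟩
      - (+ 2 * shift (J 0) n)       ≡⟨ cong -_ (2xJ₀ n) ⟩
      - (δ₁ n + E n)                ≡⟨ rearrange (δ₁ n) (E n) ⟩
      - E n - δ₁ n                  ≡⟨ cong (λ z → - z - δ₁ n) (sym (e≡E n)) ⟩
      - e n - δ₁ n                  ≡⟨ sym (Num-z⁰ n) ⟩
      Num S n 0                     ∎
    where
      rearrange : ∀ x y → - (x + y) ≡ - y - x
      rearrange = solve-∀
  J⊛Den≡Num n (suc zero) = begin
      (J 0 ⋆ column (Den S) 1) n + (J 1 ⋆ column (Den S) 0) n
        ≡⟨ cong₂ _+_ (⋆-Den-z¹ (J 0) n) (⋆-Den-z⁰ (J 1) n) ⟩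
      + 3 * shift (J 0) n + (J 0 ⋆ E) n + - (+ 2 * shift (J 1) n)
        ≡⟨ cong (λ v → + 3 * shift (J 0) n + (J 0 ⋆ E) n + - v) (2xJ-step 0 n) ⟩
      + 3 * shift (J 0) n + (J 0 ⋆ E) n + - ((J 0 ⋆ E) n + shift (J 0) n + δ₁ n - E n)
        ≡⟨ cancel (shift (J 0) n) ((J 0 ⋆ E) n) (δ₁ n) (E n) ⟩
      + 2 * shift (J 0) n - δ₁ n + E n
        ≡⟨ cong (λ z → z - δ₁ n + E n) (2xJ₀ n) ⟩
      δ₁ n + E n - δ₁ n + E n
        ≡⟨ double (δ₁ n) (E n) ⟩
      + 2 * E n
        ≡⟨ cong (+ 2 *_) (sym (e≡E n)) ⟩
      + 2 * e n
        ≡⟨ sym (Num-z¹ n) ⟩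
      Num S n 1 ∎
    where
      cancel : ∀ s c x y → + 3 * s + c + - (c + s + x - y) ≡ + 2 * s - x + y
      cancel = solve-∀
      double : ∀ x y → x + y - x + y ≡ + 2 * y
      double = solve-∀
  J⊛Den≡Num n (suc (suc l)) = begin
      sumTo (suc (suc l)) (λ j → (J j ⋆ column (Den S) (suc (suc l) ∸ j)) n)
        ≡⟨ sumTo-last-three l _ (λ j j<l → trans (cong (λ k → (J j ⋆ column (Den S) k) n) (∸-≥3 l j j<l)) (⋆-Den-z³⁺ (J j) n (l ∸ suc j))) ⟩
      (J l ⋆ column (Den S) (suc (suc l) ∸ l)) n + (J (suc l) ⋆ column (Den S) (suc l ∸ l)) n + (J (suc (suc l)) ⋆ column (Den S) (l ∸ l)) n
        ≡⟨ cong₂ _+_ (cong₂ _+_ (column-at l (m+n∸n≡m 2 l)) (column-at (suc l) (m+n∸n≡m 1 l)))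
                     (column-at (suc (suc l)) (n∸n≡0 l)) ⟩
      (J l ⋆ column (Den S) 2) n + (J (suc l) ⋆ column (Den S) 1) n + (J (suc (suc l)) ⋆ column (Den S) 0) n
        ≡⟨ cong₂ _+_ (cong₂ _+_ (⋆-Den-z² (J l) n) (⋆-Den-z¹ (J (suc l)) n)) (⋆-Den-z⁰ (J (suc (suc l))) n) ⟩
      - (s₀ + c₀) + (+ 3 * s₁ + c₁) + - (+ 2 * shift (J (suc (suc l))) n)
        ≡⟨ cong (λ z → - (s₀ + c₀) + (+ 3 * s₁ + c₁) + - z) (2xJ-step (suc l) n) ⟩
      - (s₀ + c₀) + (+ 3 * s₁ + c₁) + - (c₁ + s₁ + δ₁ n - E n)
        ≡⟨ regroup s₀ c₀ s₁ c₁ (δ₁ n) (E n) ⟩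
      + 2 * s₁ - s₀ - c₀ - δ₁ n + E n
        ≡⟨ cong (λ z → z - s₀ - c₀ - δ₁ n + E n) (2xJ-step l n) ⟩
      c₀ + s₀ + δ₁ n - E n - s₀ - c₀ - δ₁ n + E n
        ≡⟨ cancel c₀ s₀ (δ₁ n) (E n) ⟩
      + 0
        ≡⟨ sym (Num-z²⁺ n l) ⟩
      Num S n (suc (suc l)) ∎
    where
      s₀ s₁ c₀ c₁ : ℤ
      s₀ = shift (J l) n
      s₁ = shift (J (suc l)) n
      c₀ = (J l ⋆ E) n
      c₁ = (J (suc l) ⋆ E) n
      column-at : ∀ j {k k′} → k ≡ k′ → (J j ⋆ column (Den S) k) n ≡ (J j ⋆ column (Den S) k′) n
      column-at j eq = cong (λ k → (J j ⋆ column (Den S) k) n) eq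
      regroup : ∀ s c s₁ c₁ x y → - (s + c) + (+ 3 * s₁ + c₁) + - (c₁ + s₁ + x - y) ≡ + 2 * s₁ - s - c - x + y
      regroup = solve-∀
      cancel : ∀ c s x y → c + s + x - y - s - c - x + y ≡ + 0
      cancel = solve-∀

lemma1 : (A : ℕ → ℕ → ℕ) → (∀ n ℓ → Fin (A n ℓ) ↔ VHCObj n ℓ)
    → (S : ℕ → ℤ) → IsSqrtDisc S
    → ∀ n ℓ → (Jser A ⊛ Den S) n ℓ ≡ Num S n ℓ
lemma1 A A↔VHC S S-sqrt n ℓ = begin
    (Jser A ⊛ Den S) n ℓ                                            ≡⟨ ⊛-columns (Jser A) (Den S) n ℓ ⟩
    sumTo ℓ (λ j → (column (Jser A) j ⋆ column (Den S) (ℓ ∸ j)) n)   ≡⟨ sumTo-cong-≤ ℓ (λ j _ → ⋆-cong (A≡J j) (λ _ → refl) n) ⟩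
    sumTo ℓ (λ j → (J j ⋆ column (Den S) (ℓ ∸ j)) n)                ≡⟨ J⊛Den≡Num S S-sqrt n ℓ ⟩
    Num S n ℓ                                                       ∎
  where
    A≡J : ∀ j i → Jser A i j ≡ J j i
    A≡J j i = cong +_ (count-VHC A A↔VHC i j)
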